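{- Let $\mathcal{G}=(\mathcal{V},\mathcal{E},\mathbf{W})$ be an undirected weighted graph on $n$ nodes with symmetric nonnegative adjacency matrix $\mathbf{W}\in\mathbb{R}^{n\times n}$, degree matrix $\mathbf{D}=\mathrm{diag}(d_1,\dots,d_n)$ with $d_i=\sum_j \mathbf{W}_{ij}$, and Laplacian $\mathbf{L}=\mathbf{D}-\mathbf{W}$. Let $q>0$, $\mathbf{K}=q(q\mathbf{I}+\mathbf{L})^{ -1}$, let $\mathbf{y}\in\mathbb{R}^n$ and $\hat{\mathbf{x}}=\mathbf{K}\mathbf{y}$. Let $\Phi_q$ be a random rooted spanning forest of $\mathcal{G}$ with distribution $$\mathbb{P}(\Phi_q=\phi)\propto q^{|\rho(\phi)|}\prod_{\tau\in\phi}\prod_{(ij)\in\tau}\mathbf{W}_{ij},$$ and define the random vector $\tilde{\mathbf{x}}\in\mathbb{R}^n$ by $\tilde{x}(i)=y\big(r_{\Phi_q}(i)\big)$ for every node $i$. Then $\mathbb{E}[\tilde{\mathbf{x}}]=\hat{\mathbf{x}}$, and $$\mathbb{E}\left(\|\tilde{\mathbf{x}}-\hat{\mathbf{x}}\|^2\right)=\sum_{i}\mathrm{var}(\tilde{x}(i))=\mathbf{y}^t(\mathbf{I}-\mathbf{K}^2)\mathbf{y}.$$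
   Context: A (rooted) tree of $\mathcal{G}$ is a connected subgraph of $\mathcal{G}$ without cycles, using edges $(ij)$ with $\mathbf{W}_{ij}>0$, whose edges are all oriented towards one distinguished node called its root (a single node is a tree with itself as root). A rooted spanning forest $\phi$ of $\mathcal{G}$ is a set of vertex-disjoint rooted trees of $\mathcal{G}$ covering all nodes. $\rho(\phi)$ denotes the set of roots of the trees of $\phi$, so $|\rho(\phi)|$ is the number of trees. For a node $i$, $r_\phi(i)$ is the root of the tree of $\phi$ containing $i$. The product $\prod_{(ij)\in\tau}\mathbf{W}_{ij}$ is over the edges of the tree $\tau$. Expectations and variances are with respect to the randomness of $\Phi_q$, with $\mathbf{y}$ fixed. -}

module Defs where

open import Level using (0ℓ)
open import Data.Nat as ℕ using (ℕ; zero; suc)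
open import Data.Fin using (Fin; zero; suc)
open import Data.Fin.Properties using (all?)
import Data.Fin as Fin
open import Data.Maybe using (Maybe; nothing; just)
open import Data.Maybe.Properties using (≡-dec)
open import Data.Unit using (⊤; tt)
open import Data.Product using (_×_)
open import Data.Sum using (_⊎_)
open import Data.Bool using (if_then_else_)
open import Data.Vec.Functional using (_∷_)
open import Relation.Nullary using (Dec; yes; no; ¬_)
open import Relation.Nullary.Decidable using (⌊_⌋; _×-dec_)
open import Relation.Binary.PropositionalEquality using (_≡_; _≢_)
open import Relation.Binary.Core using (Rel)
open import Relation.Binary.Structures using (IsStrictTotalOrder)
open import Algebra.Core using (Op₁; Op₂)
open import Algebra.Structures using (IsCommutativeRing)

record OrderedField : Set₁ where
  infixl 6 _+_ _-_
  infixl 7 _*_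
  infix 4 _<_ _≤_
  field
    Carrier : Set
    _+_ _*_ : Op₂ Carrier
    -_      : Op₁ Carrier
    0# 1#   : Carrier
    isCommutativeRing : IsCommutativeRing _≡_ _+_ _*_ -_ 0# 1#
    _⁻¹     : Op₁ Carrier
    ⁻¹-inverse : ∀ x → x ≢ 0# → x * (x ⁻¹) ≡ 1#
    0≢1     : 0# ≢ 1#
    _<_     : Rel Carrier 0ℓ
    isStrictTotalOrder : IsStrictTotalOrder _≡_ _<_
    +-mono-< : ∀ {x y} z → x < y → x + z < y + z
    *-pos   : ∀ {x y} → 0# < x → 0# < y → 0# < x * y

  _-_ : Op₂ Carrier
  x - y = x + (- y)

  _≤_ : Rel Carrier 0ℓ
  x ≤ y = (x < y) ⊎ (x ≡ y)

  open IsStrictTotalOrder isStrictTotalOrder public using (_<?_)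

module Graph (F : OrderedField) where
  open OrderedField F

  Σ : ∀ n → (Fin n → Carrier) → Carrier
  Σ zero    f = 0#
  Σ (suc n) f = f zero + Σ n (λ i → f (suc i))

  Π : ∀ n → (Fin n → Carrier) → Carrier
  Π zero    f = 1#
  Π (suc n) f = f zero * Π n (λ i → f (suc i))

  Matrix : ℕ → Set
  Matrix n = Fin n → Fin n → Carrier

  δ : ∀ {n} → Fin n → Fin n → Carrier
  δ i j with i Fin.≟ j
  ... | yes _ = 1#
  ... | no  _ = 0#

  degree : ∀ {n} → Matrix n → Fin n → Carrier
  degree {n} W i = Σ n (λ j → W i j)

  laplacian : ∀ {n} → Matrix n → Matrix n
  laplacian W i j = δ i j * degree W i - W i j

  _⊗_ : ∀ {n} → Matrix n → Matrix n → Matrix n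
  _⊗_ {n} A B i j = Σ n (λ k → A i k * B k j)

  _·_ : ∀ {n} → Matrix n → (Fin n → Carrier) → (Fin n → Carrier)
  _·_ {n} A v i = Σ n (λ k → A i k * v k)

  quad : ∀ {n} → Matrix n → (Fin n → Carrier) → Carrier
  quad {n} A y = Σ n (λ i → y i * (A · y) i)

  -- Rooted spanning forests, encoded by their parent map:
  -- p i = nothing  iff  i is a root;  p i = just j  iff  (i j) is an edge
  -- of the forest oriented towards the root.

  ParentMap : ℕ → Set
  ParentMap n = Fin n → Maybe (Fin n)

  step : ∀ {n} → ParentMap n → Fin n → Fin n
  step p i with p i
  ... | nothing = i
  ... | just j  = j

  reach : ∀ {n} → ParentMap n → ℕ → Fin n → Fin n
  reach p zero    i = i
  reach p (suc k) i = reach p k (step p i)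

  root : ∀ {n} → ParentMap n → Fin n → Fin n
  root {n} p i = reach p n i

  -- no cycles: following parents from any node reaches a root
  Acyclic : ∀ {n} → ParentMap n → Set
  Acyclic {n} p = ∀ i → p (reach p n i) ≡ nothing

  EdgeOK : ∀ {n} → Matrix n → Fin n → Maybe (Fin n) → Set
  EdgeOK W i nothing  = ⊤
  EdgeOK W i (just j) = 0# < W i j

  IsForest : ∀ {n} → Matrix n → ParentMap n → Set
  IsForest W p = Acyclic p × (∀ i → EdgeOK W i (p i))

  edgeOK? : ∀ {n} (W : Matrix n) i m → Dec (EdgeOK W i m)
  edgeOK? W i nothing  = yes tt
  edgeOK? W i (just j) = 0# <? W i j

  isForest? : ∀ {n} (W : Matrix n) (p : ParentMap n) → Dec (IsForest W p)
  isForest? {n} W p =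
    all? (λ i → ≡-dec Fin._≟_ (p (reach p n i)) nothing)
    ×-dec all? (λ i → edgeOK? W i (p i))

  ΣMaps : ∀ n {m} → ((Fin n → Maybe (Fin m)) → Carrier) → Carrier
  ΣMaps zero    {m} f = f (λ ())
  ΣMaps (suc n) {m} f =
    ΣMaps n (λ g → f (nothing ∷ g))
    + Σ m (λ j → ΣMaps n (λ g → f (just j ∷ g)))

  nodeWeight : ∀ {n} → Carrier → Matrix n → Fin n → Maybe (Fin n) → Carrier
  nodeWeight q W i nothing  = q
  nodeWeight q W i (just j) = W i j

  -- unnormalised weight  q^|ρ(φ)| ∏_τ ∏_(ij)∈τ W_ij  (0 if not a forest)
  forestWeight : ∀ {n} → Carrier → Matrix n → ParentMap n → Carrier
  forestWeight {n} q W p =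
    if ⌊ isForest? W p ⌋ then Π n (λ i → nodeWeight q W i (p i)) else 0#

  Z : ∀ {n} → Carrier → Matrix n → Carrier
  Z {n} q W = ΣMaps n (forestWeight q W)

  𝔼 : ∀ {n} → Carrier → Matrix n → (ParentMap n → Carrier) → Carrier
  𝔼 {n} q W f = ΣMaps n (λ p → forestWeight q W p * f p) * (Z q W ⁻¹)

  var : ∀ {n} → Carrier → Matrix n → (ParentMap n → Carrier) → Carrier
  var q W f = 𝔼 q W (λ p → (f p - 𝔼 q W f) * (f p - 𝔼 q W f))

-- Let M i j be the total weight of the forests in which the root of i is j,
-- so that 𝔼[x̃(i)] = Σⱼ M i j y(j) / Z.  Re-choosing the parent of i in a
-- forest (none: i becomes a root, factor q; or a node m outside the tree of i:
-- factor W i m, and the tree of i takes the root of m) shows that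
-- (q I + L) M = q Z I.  The operator q I + L is injective by the maximum
-- principle (at a maximum of a solution of (q I + L) v = 0 one gets q v ≤ 0),
-- hence M = Z K and 𝔼[x̃] = K y.  Taking y = 1 shows that K has unit row sums,
-- and K is symmetric because L is, so Σᵢ 𝔼[x̃(i)²] = Σᵢ (K y²)(i) = Σ y² and
-- Σᵢ var x̃(i) = yᵗ y − |K y|² = yᵗ (I − K²) y.

module Submission where

open import Defs
open import Data.Nat using (ℕ)
open import Data.Fin using (Fin)
open import Data.Product using (_×_)
open import Relation.Binary.PropositionalEquality using (_≡_)

open import Level using (0ℓ)
open import Data.Nat as ℕ using (zero; suc)
import Data.Nat.Properties as ℕ
open import Data.Fin as Fin using (zero; suc)
import Data.Fin.Properties as Fin
open import Data.Product using (_,_; proj₁; proj₂; ∃-syntax)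
open import Data.Sum using (inj₁; inj₂; [_,_]′)
open import Data.Unit using (tt)
open import Data.Maybe using (Maybe; just; nothing)
open import Data.Vec.Functional using (_∷_)
open import Data.List using (allFin)
import Data.List.Relation.Unary.All as All
open import Data.List.Membership.Propositional.Properties using (∈-allFin)
import Data.List.Extrema
open import Function using (_∘_)
open import Relation.Nullary using (¬_; yes; no; contradiction)
open import Relation.Nullary.Decidable using (toSum)
open import Relation.Binary.PropositionalEquality
  using (_≢_; refl; sym; trans; cong; cong₂; subst; subst₂; module ≡-Reasoning)
open import Relation.Binary.Bundles using (TotalOrder)
open import Relation.Binary.Structures using (IsStrictTotalOrder)
open import Relation.Binary.Definitions using (tri<; tri≈; tri>)
import Relation.Binary.Construct.StrictToNonStrict as StrictToNonStrict
open import Algebra.Bundles using (CommutativeRing; RawRing)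
open import Algebra.Core using (Op₁; Op₂)
open import Algebra.Structures using (IsCommutativeRing)
import Algebra.Solver.Ring.AlmostCommutativeRing as ACR

module IntegerCoefficientSolver
  {A : Set} {add mul : Op₂ A} {neg : Op₁ A} {0r 1r : A}
  (isCommutativeRing : IsCommutativeRing _≡_ add mul neg 0r 1r) where

  private
    R : CommutativeRing 0ℓ 0ℓ
    R = record { isCommutativeRing = isCommutativeRing }

  open CommutativeRing R using (_+_; _*_; -_; _-_; 0#; 1#; +-identityˡ; +-identityʳ; -‿inverseʳ; semiring)
  open import Algebra.Properties.CommutativeSemigroup (CommutativeRing.+-commutativeSemigroup R) using (interchange)
  open import Algebra.Properties.AbelianGroup (CommutativeRing.+-abelianGroup R) using (⁻¹-∙-comm; ⁻¹-anti-homo‿-)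
  open import Algebra.Properties.Ring (CommutativeRing.ring R) using (-0#≈0#; x[y-z]≈xy-xz; [y-z]x≈yx-zx)
  open import Algebra.Properties.Semiring.Mult.TCOptimised semiring using (1+×; ×-homo-+; ×1-homo-*) renaming (_×_ to _·1_)
  open ≡-Reasoning

  private
    ⌜_⌝ : ℕ → A
    ⌜ n ⌝ = n ·1 1#

    -‿distrib-+ : ∀ x y → - (x + y) ≡ - x + - y
    -‿distrib-+ x y = sym (⁻¹-∙-comm x y)

  -- An integer is represented as a difference a − b of naturals; the
  -- arithmetic keeps it normalised (one side zero), so that the
  -- coefficients of two normal forms are compared by computation.
  ℤ₋ : Set
  ℤ₋ = ℕ × ℕ

  normalise : ℕ → ℕ → ℤ₋
  normalise a b = (a ℕ.∸ b , b ℕ.∸ a)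

  _+ᶻ_ _*ᶻ_ : Op₂ ℤ₋
  (a , b) +ᶻ (c , d) = normalise (a ℕ.+ c) (b ℕ.+ d)
  (a , b) *ᶻ (c , d) = normalise (a ℕ.* c ℕ.+ b ℕ.* d) (a ℕ.* d ℕ.+ b ℕ.* c)

  -ᶻ_ : Op₁ ℤ₋
  -ᶻ (a , b) = (b , a)

  -- the two cases make ⟦ 0 , 0 ⟧ and ⟦ 1 , 0 ⟧ reduce to 0# and 1#
  ⟦_⟧ : ℤ₋ → A
  ⟦ a , zero ⟧  = ⌜ a ⌝
  ⟦ a , suc b ⟧ = ⌜ a ⌝ - ⌜ suc b ⌝

  ⟦⟧-difference : ∀ a b → ⟦ a , b ⟧ ≡ ⌜ a ⌝ - ⌜ b ⌝
  ⟦⟧-difference a zero    = sym (trans (cong (⌜ a ⌝ +_) -0#≈0#) (+-identityʳ _))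
  ⟦⟧-difference a (suc b) = refl

  ⟦normalise⟧ : ∀ a b → ⟦ normalise a b ⟧ ≡ ⌜ a ⌝ - ⌜ b ⌝
  ⟦normalise⟧ zero    zero    = ⟦⟧-difference 0 0
  ⟦normalise⟧ zero    (suc b) = refl
  ⟦normalise⟧ (suc a) zero    = ⟦⟧-difference (suc a) 0
  ⟦normalise⟧ (suc a) (suc b) = begin
    ⟦ normalise a b ⟧                     ≡⟨ ⟦normalise⟧ a b ⟩
    ⌜ a ⌝ - ⌜ b ⌝                         ≡⟨ sym (+-identityˡ _) ⟩
    0# + (⌜ a ⌝ - ⌜ b ⌝)                  ≡⟨ cong (_+ (⌜ a ⌝ - ⌜ b ⌝)) (sym (-‿inverseʳ 1#)) ⟩
    (1# - 1#) + (⌜ a ⌝ - ⌜ b ⌝)           ≡⟨ interchange _ _ _ _ ⟩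
    (1# + ⌜ a ⌝) + (- 1# + - ⌜ b ⌝)       ≡⟨ cong ((1# + ⌜ a ⌝) +_) (sym (-‿distrib-+ 1# ⌜ b ⌝)) ⟩
    (1# + ⌜ a ⌝) - (1# + ⌜ b ⌝)           ≡⟨ sym (cong₂ _-_ (1+× a 1#) (1+× b 1#)) ⟩
    ⌜ suc a ⌝ - ⌜ suc b ⌝                 ∎

  +ᶻ-homo : ∀ x y → ⟦ x +ᶻ y ⟧ ≡ ⟦ x ⟧ + ⟦ y ⟧
  +ᶻ-homo (a , b) (c , d) = begin
    ⟦ normalise (a ℕ.+ c) (b ℕ.+ d) ⟧        ≡⟨ ⟦normalise⟧ (a ℕ.+ c) (b ℕ.+ d) ⟩
    ⌜ a ℕ.+ c ⌝ - ⌜ b ℕ.+ d ⌝                ≡⟨ cong₂ _-_ (×-homo-+ 1# a c) (×-homo-+ 1# b d) ⟩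
    (⌜ a ⌝ + ⌜ c ⌝) - (⌜ b ⌝ + ⌜ d ⌝)        ≡⟨ cong ((⌜ a ⌝ + ⌜ c ⌝) +_) (-‿distrib-+ _ _) ⟩
    (⌜ a ⌝ + ⌜ c ⌝) + (- ⌜ b ⌝ + - ⌜ d ⌝)    ≡⟨ interchange _ _ _ _ ⟩
    (⌜ a ⌝ - ⌜ b ⌝) + (⌜ c ⌝ - ⌜ d ⌝)        ≡⟨ sym (cong₂ _+_ (⟦⟧-difference a b) (⟦⟧-difference c d)) ⟩
    ⟦ a , b ⟧ + ⟦ c , d ⟧                    ∎

  *ᶻ-homo : ∀ x y → ⟦ x *ᶻ y ⟧ ≡ ⟦ x ⟧ * ⟦ y ⟧
  *ᶻ-homo (a , b) (c , d) = begin
    ⟦ normalise (a ℕ.* c ℕ.+ b ℕ.* d) (a ℕ.* d ℕ.+ b ℕ.* c) ⟧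
      ≡⟨ ⟦normalise⟧ (a ℕ.* c ℕ.+ b ℕ.* d) (a ℕ.* d ℕ.+ b ℕ.* c) ⟩
    ⌜ a ℕ.* c ℕ.+ b ℕ.* d ⌝ - ⌜ a ℕ.* d ℕ.+ b ℕ.* c ⌝
      ≡⟨ cong₂ _-_ (⌜⌝-bilinear a c b d) (⌜⌝-bilinear a d b c) ⟩
    (a′ * c′ + b′ * d′) - (a′ * d′ + b′ * c′)          ≡⟨ cong ((a′ * c′ + b′ * d′) +_) (-‿distrib-+ _ _) ⟩
    (a′ * c′ + b′ * d′) + (- (a′ * d′) + - (b′ * c′))  ≡⟨ interchange _ _ _ _ ⟩
    (a′ * c′ - a′ * d′) + (b′ * d′ - b′ * c′)          ≡⟨ cong ((a′ * c′ - a′ * d′) +_) (sym (⁻¹-anti-homo‿- _ _)) ⟩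
    (a′ * c′ - a′ * d′) - (b′ * c′ - b′ * d′)          ≡⟨ sym (cong₂ _-_ (x[y-z]≈xy-xz a′ c′ d′) (x[y-z]≈xy-xz b′ c′ d′)) ⟩
    a′ * (c′ - d′) - b′ * (c′ - d′)                    ≡⟨ sym ([y-z]x≈yx-zx (c′ - d′) a′ b′) ⟩
    (a′ - b′) * (c′ - d′)                              ≡⟨ sym (cong₂ _*_ (⟦⟧-difference a b) (⟦⟧-difference c d)) ⟩
    ⟦ a , b ⟧ * ⟦ c , d ⟧                              ∎
    where
    a′ = ⌜ a ⌝; b′ = ⌜ b ⌝; c′ = ⌜ c ⌝; d′ = ⌜ d ⌝
    ⌜⌝-bilinear : ∀ m n k l → ⌜ m ℕ.* n ℕ.+ k ℕ.* l ⌝ ≡ ⌜ m ⌝ * ⌜ n ⌝ + ⌜ k ⌝ * ⌜ l ⌝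
    ⌜⌝-bilinear m n k l = trans (×-homo-+ 1# (m ℕ.* n) (k ℕ.* l)) (cong₂ _+_ (×1-homo-* m n) (×1-homo-* k l))

  -ᶻ-homo : ∀ x → ⟦ -ᶻ x ⟧ ≡ - ⟦ x ⟧
  -ᶻ-homo (a , b) = begin
    ⟦ b , a ⟧             ≡⟨ ⟦⟧-difference b a ⟩
    ⌜ b ⌝ - ⌜ a ⌝         ≡⟨ sym (⁻¹-anti-homo‿- ⌜ a ⌝ ⌜ b ⌝) ⟩
    - (⌜ a ⌝ - ⌜ b ⌝)     ≡⟨ cong -_ (sym (⟦⟧-difference a b)) ⟩
    - ⟦ a , b ⟧           ∎

  private
    coefficients : RawRing 0ℓ 0ℓ
    coefficients = record
      { Carrier = ℤ₋ ; _≈_ = _≡_ ; _+_ = _+ᶻ_ ; _*_ = _*ᶻ_ ; -_ = -ᶻ_ ; 0# = (0 , 0) ; 1# = (1 , 0) }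

    ring : ACR.AlmostCommutativeRing 0ℓ 0ℓ
    ring = ACR.fromCommutativeRing R

    morphism : ACR._-Raw-AlmostCommutative⟶_ coefficients ring
    morphism = record
      { ⟦_⟧ = ⟦_⟧ ; +-homo = +ᶻ-homo ; *-homo = *ᶻ-homo ; -‿homo = -ᶻ-homo ; 0-homo = refl ; 1-homo = refl }

    ⟦⟧-equal? : ∀ x y → Maybe (⟦ x ⟧ ≡ ⟦ y ⟧)
    ⟦⟧-equal? (a , b) (c , d) with a ℕ.≟ c | b ℕ.≟ d
    ... | yes refl | yes refl = just refl
    ... | _        | _        = nothing

  open import Algebra.Solver.Ring coefficients ring morphism ⟦⟧-equal? public
    using (Polynomial; solve; _:=_; _:+_; _:*_; _:-_; :-_; con)

  :0 :1 : ∀ {n} → Polynomial n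
  :0 = con (0 , 0)
  :1 = con (1 , 0)

module OrderedFieldProperties (F : OrderedField) where
  open OrderedField F
  open ≡-Reasoning

  commutativeRing : CommutativeRing 0ℓ 0ℓ
  commutativeRing = record { isCommutativeRing = isCommutativeRing }

  open CommutativeRing commutativeRing public
    using ( +-comm; *-assoc; *-comm; +-identityˡ; +-identityʳ; *-identityˡ; *-identityʳ
          ; distribˡ; distribʳ; zeroˡ; zeroʳ)
  open import Algebra.Properties.Ring (CommutativeRing.ring commutativeRing) public
    using (-‿distribʳ-*)
  open IntegerCoefficientSolver isCommutativeRing public
    using (solve; _:=_; _:+_; _:*_; _:-_; :-_; :0; :1)

  private
    module <-Order = IsStrictTotalOrder isStrictTotalOrder

  ≤-totalOrder : TotalOrder 0ℓ 0ℓ 0ℓ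
  ≤-totalOrder = record { isTotalOrder = StrictToNonStrict.isTotalOrder _≡_ _<_ isStrictTotalOrder }

  open TotalOrder ≤-totalOrder public using () renaming (refl to ≤-refl; trans to ≤-trans; antisym to ≤-antisym)

  <-irrefl : ∀ {x} → ¬ (x < x)
  <-irrefl = <-Order.irrefl refl

  ≤-<-trans : ∀ {x y z} → x ≤ y → y < z → x < z
  ≤-<-trans = StrictToNonStrict.≤-<-trans _≡_ _<_ sym <-Order.trans (λ { refl x<z → x<z })

  pos⇒≢0 : ∀ {x} → 0# < x → x ≢ 0#
  pos⇒≢0 0<x refl = <-irrefl 0<x

  +-monoˡ-≤ : ∀ {x y} z → x ≤ y → x + z ≤ y + z
  +-monoˡ-≤ z (inj₁ x<y)  = inj₁ (+-mono-< z x<y)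
  +-monoˡ-≤ z (inj₂ refl) = ≤-refl

  +-mono-≤ : ∀ {x y u v} → x ≤ y → u ≤ v → x + u ≤ y + v
  +-mono-≤ {x} {y} {u} {v} x≤y u≤v = ≤-trans (+-monoˡ-≤ u x≤y)
    (subst₂ _≤_ (+-comm u y) (+-comm v y) (+-monoˡ-≤ y u≤v))

  +-mono-<-≤ : ∀ {x y u v} → x < y → u ≤ v → x + u < y + v
  +-mono-<-≤ {x} {y} {u} {v} x<y (inj₁ u<v) = <-Order.trans (+-mono-< u x<y)
    (subst₂ _<_ (+-comm u y) (+-comm v y) (+-mono-< y u<v))
  +-mono-<-≤ x<y (inj₂ refl) = +-mono-< _ x<y

  x≤y⇒0≤y-x : ∀ {x y} → x ≤ y → 0# ≤ y - x
  x≤y⇒0≤y-x {x} {y} x≤y =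
    subst₂ _≤_ (solve 1 (λ x → x :- x := :0) refl x) refl (+-monoˡ-≤ (- x) x≤y)

  0≤y-x⇒x≤y : ∀ {x y} → 0# ≤ y - x → x ≤ y
  0≤y-x⇒x≤y {x} {y} 0≤y-x =
    subst₂ _≤_ (+-identityˡ x) (solve 2 (λ x y → y :- x :+ x := y) refl x y) (+-monoˡ-≤ x 0≤y-x)

  -x≤0⇒0≤x : ∀ {x} → - x ≤ 0# → 0# ≤ x
  -x≤0⇒0≤x {x} -x≤0 =
    subst₂ _≤_ (solve 1 (λ x → :- x :+ x := :0) refl x) (+-identityˡ x) (+-monoˡ-≤ x -x≤0)

  *-nonneg : ∀ {x y} → 0# ≤ x → 0# ≤ y → 0# ≤ x * y
  *-nonneg (inj₁ 0<x) (inj₁ 0<y)                = inj₁ (*-pos 0<x 0<y)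
  *-nonneg {y = y} (inj₂ refl) _                = inj₂ (sym (zeroˡ y))
  *-nonneg {x = x} (inj₁ _) (inj₂ refl)         = inj₂ (sym (zeroʳ x))

  *-monoˡ-≤-nonneg : ∀ {c x y} → 0# ≤ c → x ≤ y → c * x ≤ c * y
  *-monoˡ-≤-nonneg {c} {x} {y} 0≤c x≤y = 0≤y-x⇒x≤y (subst (0# ≤_)
    (solve 3 (λ c x y → c :* (y :- x) := c :* y :- c :* x) refl c x y)
    (*-nonneg 0≤c (x≤y⇒0≤y-x x≤y)))

  pos*x≤0⇒x≤0 : ∀ {q x} → 0# < q → q * x ≤ 0# → x ≤ 0#
  pos*x≤0⇒x≤0 {q} {x} 0<q qx≤0 with <-Order.compare x 0#
  ... | tri< x<0 _ _ = inj₁ x<0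
  ... | tri≈ _ x≡0 _ = inj₂ x≡0
  ... | tri> _ _ 0<x = contradiction (≤-<-trans qx≤0 (*-pos 0<q 0<x)) <-irrefl

  0<1 : 0# < 1#
  0<1 with <-Order.compare 0# 1#
  ... | tri< 0<1 _ _ = 0<1
  ... | tri≈ _ 0≡1 _ = contradiction 0≡1 0≢1
  ... | tri> _ _ 1<0 = contradiction (<-Order.trans 1<0 (subst (0# <_) [-1]*[-1]≡1 (*-pos 0<-1 0<-1))) <-irrefl
    where
    0<-1 : 0# < - 1#
    0<-1 = subst₂ _<_ (solve 1 (λ x → x :- x := :0) refl 1#) (+-identityˡ (- 1#)) (+-mono-< (- 1#) 1<0)
    [-1]*[-1]≡1 : - 1# * - 1# ≡ 1#
    [-1]*[-1]≡1 = solve 0 (:- :1 :* :- :1 := :1) refl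

  *-cancelˡ : ∀ {x y z} → x ≢ 0# → x * y ≡ x * z → y ≡ z
  *-cancelˡ {x} {y} {z} x≢0 xy≡xz =
    trans (sym (x⁻¹*[x*y]≡y y)) (trans (cong (x ⁻¹ *_) xy≡xz) (x⁻¹*[x*y]≡y z))
    where
    x⁻¹*[x*y]≡y : ∀ y → x ⁻¹ * (x * y) ≡ y
    x⁻¹*[x*y]≡y y = begin
      x ⁻¹ * (x * y)  ≡⟨ solve 3 (λ u x y → u :* (x :* y) := x :* u :* y) refl (x ⁻¹) x y ⟩
      x * x ⁻¹ * y    ≡⟨ cong (_* y) (⁻¹-inverse x x≢0) ⟩
      1# * y          ≡⟨ *-identityˡ y ⟩
      y               ∎

module FiniteSums (F : OrderedField) where
  open OrderedField F
  open Graph F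
  open OrderedFieldProperties F
  open ≡-Reasoning

  Σ-cong : ∀ n {f g : Fin n → Carrier} → (∀ i → f i ≡ g i) → Σ n f ≡ Σ n g
  Σ-cong zero    f≗g = refl
  Σ-cong (suc n) f≗g = cong₂ _+_ (f≗g zero) (Σ-cong n (λ i → f≗g (suc i)))

  Σ-zero : ∀ n → Σ n (λ _ → 0#) ≡ 0#
  Σ-zero zero    = refl
  Σ-zero (suc n) = trans (cong (0# +_) (Σ-zero n)) (+-identityʳ 0#)

  Σ-distrib-+ : ∀ n (f g : Fin n → Carrier) → Σ n (λ i → f i + g i) ≡ Σ n f + Σ n g
  Σ-distrib-+ zero    f g = sym (+-identityʳ 0#)
  Σ-distrib-+ (suc n) f g = trans (cong (f zero + g zero +_) (Σ-distrib-+ n _ _))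
    (solve 4 (λ a b c d → a :+ b :+ (c :+ d) := a :+ c :+ (b :+ d)) refl _ _ _ _)

  *-distribˡ-Σ : ∀ n c (f : Fin n → Carrier) → c * Σ n f ≡ Σ n (λ i → c * f i)
  *-distribˡ-Σ zero    c f = zeroʳ c
  *-distribˡ-Σ (suc n) c f = trans (distribˡ c _ _) (cong (c * f zero +_) (*-distribˡ-Σ n c _))

  *-distribʳ-Σ : ∀ n c (f : Fin n → Carrier) → Σ n f * c ≡ Σ n (λ i → f i * c)
  *-distribʳ-Σ n c f =
    trans (*-comm _ c) (trans (*-distribˡ-Σ n c f) (Σ-cong n (λ i → *-comm c (f i))))

  Σ-distrib-- : ∀ n (f g : Fin n → Carrier) → Σ n (λ i → f i - g i) ≡ Σ n f - Σ n g
  Σ-distrib-- n f g = begin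
    Σ n (λ i → f i - g i)            ≡⟨ Σ-cong n (λ i → cong (f i +_) (solve 1 (λ x → :- x := :- :1 :* x) refl (g i))) ⟩
    Σ n (λ i → f i + - 1# * g i)     ≡⟨ Σ-distrib-+ n _ _ ⟩
    Σ n f + Σ n (λ i → - 1# * g i)   ≡⟨ cong (Σ n f +_) (sym (*-distribˡ-Σ n (- 1#) g)) ⟩
    Σ n f + - 1# * Σ n g             ≡⟨ cong (Σ n f +_) (solve 1 (λ x → :- :1 :* x := :- x) refl (Σ n g)) ⟩
    Σ n f - Σ n g                    ∎

  Σ-comm : ∀ n m (f : Fin n → Fin m → Carrier) →
    Σ n (λ i → Σ m (λ j → f i j)) ≡ Σ m (λ j → Σ n (λ i → f i j))
  Σ-comm zero    m f = sym (Σ-zero m)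
  Σ-comm (suc n) m f =
    trans (cong (Σ m (f zero) +_) (Σ-comm n m (λ i → f (suc i)))) (sym (Σ-distrib-+ m _ _))

  Σ-nonneg : ∀ n (f : Fin n → Carrier) → (∀ i → 0# ≤ f i) → 0# ≤ Σ n f
  Σ-nonneg zero    f 0≤f = ≤-refl
  Σ-nonneg (suc n) f 0≤f =
    subst (_≤ Σ (suc n) f) (+-identityʳ 0#) (+-mono-≤ (0≤f zero) (Σ-nonneg n _ (λ i → 0≤f (suc i))))

  Σ-mono-≤ : ∀ n (f g : Fin n → Carrier) → (∀ i → f i ≤ g i) → Σ n f ≤ Σ n g
  Σ-mono-≤ zero    f g f≤g = ≤-refl
  Σ-mono-≤ (suc n) f g f≤g = +-mono-≤ (f≤g zero) (Σ-mono-≤ n _ _ (λ i → f≤g (suc i)))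

  Σ-single : ∀ n (f : Fin n → Carrier) i → (∀ k → k ≢ i → f k ≡ 0#) → Σ n f ≡ f i
  Σ-single (suc n) f zero f≡0 = begin
    f zero + Σ n (λ k → f (suc k)) ≡⟨ cong (f zero +_) (trans (Σ-cong n (λ k → f≡0 (suc k) λ ())) (Σ-zero n)) ⟩
    f zero + 0#                    ≡⟨ +-identityʳ _ ⟩
    f zero                         ∎
  Σ-single (suc n) f (suc i) f≡0 = begin
    f zero + Σ n (λ k → f (suc k)) ≡⟨ cong (_+ Σ n (λ k → f (suc k))) (f≡0 zero λ ()) ⟩
    0# + Σ n (λ k → f (suc k))     ≡⟨ +-identityˡ _ ⟩
    Σ n (λ k → f (suc k))
      ≡⟨ Σ-single n (λ k → f (suc k)) i (λ k k≢i → f≡0 (suc k) (k≢i ∘ Fin.suc-injective)) ⟩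
    f (suc i)                      ∎

  δ-refl : ∀ {n} (i : Fin n) → δ i i ≡ 1#
  δ-refl i with i Fin.≟ i
  ... | yes _   = refl
  ... | no  i≢i = contradiction refl i≢i

  δ-≢ : ∀ {n} {i j : Fin n} → i ≢ j → δ i j ≡ 0#
  δ-≢ {i = i} {j} i≢j with i Fin.≟ j
  ... | yes i≡j = contradiction i≡j i≢j
  ... | no  _   = refl

  δ-≡ : ∀ {n} {i j : Fin n} → i ≡ j → δ i j ≡ 1#
  δ-≡ {i = i} refl = δ-refl i

  δ-sym : ∀ {n} (i j : Fin n) → δ i j ≡ δ j i
  δ-sym i j with i Fin.≟ j
  ... | yes i≡j = sym (δ-≡ (sym i≡j))
  ... | no  i≢j = sym (δ-≢ (i≢j ∘ sym))

  Σ-δ : ∀ n (i : Fin n) (f : Fin n → Carrier) → Σ n (λ k → δ i k * f k) ≡ f i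
  Σ-δ n i f = begin
    Σ n (λ k → δ i k * f k) ≡⟨ Σ-single n _ i (λ k k≢i → trans (cong (_* f k) (δ-≢ (k≢i ∘ sym))) (zeroˡ (f k))) ⟩
    δ i i * f i             ≡⟨ cong (_* f i) (δ-refl i) ⟩
    1# * f i                ≡⟨ *-identityˡ (f i) ⟩
    f i                     ∎

  Π-cong : ∀ n {f g : Fin n → Carrier} → (∀ i → f i ≡ g i) → Π n f ≡ Π n g
  Π-cong zero    f≗g = refl
  Π-cong (suc n) f≗g = cong₂ _*_ (f≗g zero) (Π-cong n (λ i → f≗g (suc i)))

  Π-nonneg : ∀ n (f : Fin n → Carrier) → (∀ i → 0# ≤ f i) → 0# ≤ Π n f
  Π-nonneg zero    f 0≤f = inj₁ 0<1
  Π-nonneg (suc n) f 0≤f = *-nonneg (0≤f zero) (Π-nonneg n _ (λ i → 0≤f (suc i)))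

  Π-pos : ∀ n (f : Fin n → Carrier) → (∀ i → 0# < f i) → 0# < Π n f
  Π-pos zero    f 0<f = 0<1
  Π-pos (suc n) f 0<f = *-pos (0<f zero) (Π-pos n _ (λ i → 0<f (suc i)))

  Π-exchange : ∀ n (f g : Fin n → Carrier) i → (∀ k → k ≢ i → f k ≡ g k) →
    f i * Π n g ≡ g i * Π n f
  Π-exchange (suc n) f g zero f≗g = begin
    f zero * (g zero * Π n (λ k → g (suc k)))
      ≡⟨ cong (λ t → f zero * (g zero * t)) (Π-cong n (λ k → sym (f≗g (suc k) λ ()))) ⟩
    f zero * (g zero * Π n (λ k → f (suc k)))
      ≡⟨ solve 3 (λ a b c → a :* (b :* c) := b :* (a :* c)) refl _ _ _ ⟩
    g zero * (f zero * Π n (λ k → f (suc k))) ∎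
  Π-exchange (suc n) f g (suc i) f≗g = begin
    f (suc i) * (g zero * Π n (λ k → g (suc k)))
      ≡⟨ solve 3 (λ a b c → a :* (b :* c) := b :* (a :* c)) refl _ _ _ ⟩
    g zero * (f (suc i) * Π n (λ k → g (suc k)))
      ≡⟨ cong₂ _*_ (sym (f≗g zero λ ()))
           (Π-exchange n (λ k → f (suc k)) (λ k → g (suc k)) i (λ k k≢i → f≗g (suc k) (k≢i ∘ Fin.suc-injective))) ⟩
    f zero * (g (suc i) * Π n (λ k → f (suc k)))
      ≡⟨ solve 3 (λ a b c → a :* (b :* c) := b :* (a :* c)) refl _ _ _ ⟩
    g (suc i) * (f zero * Π n (λ k → f (suc k))) ∎

  ΣMaps-cong : ∀ n {m} {f g : (Fin n → Maybe (Fin m)) → Carrier} → (∀ p → f p ≡ g p) →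
    ΣMaps n f ≡ ΣMaps n g
  ΣMaps-cong zero        f≗g = f≗g _
  ΣMaps-cong (suc n) {m} f≗g =
    cong₂ _+_ (ΣMaps-cong n (λ p → f≗g _)) (Σ-cong m (λ j → ΣMaps-cong n (λ p → f≗g _)))

  ΣMaps-zero : ∀ n {m} → ΣMaps n {m} (λ _ → 0#) ≡ 0#
  ΣMaps-zero zero        = refl
  ΣMaps-zero (suc n) {m} =
    trans (cong₂ _+_ (ΣMaps-zero n) (trans (Σ-cong m (λ j → ΣMaps-zero n)) (Σ-zero m))) (+-identityʳ 0#)

  ΣMaps-Σ-comm : ∀ n {m} k (f : (Fin n → Maybe (Fin m)) → Fin k → Carrier) →
    ΣMaps n (λ p → Σ k (f p)) ≡ Σ k (λ j → ΣMaps n (λ p → f p j))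
  ΣMaps-Σ-comm zero        k f = refl
  ΣMaps-Σ-comm (suc n) {m} k f = trans
    (cong₂ _+_ (ΣMaps-Σ-comm n k _) (trans (Σ-cong m (λ l → ΣMaps-Σ-comm n k _)) (Σ-comm m k _)))
    (sym (Σ-distrib-+ k _ _))

  ΣMaps-distrib-+ : ∀ n {m} (f g : (Fin n → Maybe (Fin m)) → Carrier) →
    ΣMaps n (λ p → f p + g p) ≡ ΣMaps n f + ΣMaps n g
  ΣMaps-distrib-+ zero        f g = refl
  ΣMaps-distrib-+ (suc n) {m} f g = trans
    (cong₂ _+_ (ΣMaps-distrib-+ n _ _) (trans (Σ-cong m (λ j → ΣMaps-distrib-+ n _ _)) (Σ-distrib-+ m _ _)))
    (solve 4 (λ a b c d → a :+ b :+ (c :+ d) := a :+ c :+ (b :+ d)) refl _ _ _ _)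

  *-distribˡ-ΣMaps : ∀ n {m} c (f : (Fin n → Maybe (Fin m)) → Carrier) →
    c * ΣMaps n f ≡ ΣMaps n (λ p → c * f p)
  *-distribˡ-ΣMaps zero        c f = refl
  *-distribˡ-ΣMaps (suc n) {m} c f = trans (distribˡ c _ _)
    (cong₂ _+_ (*-distribˡ-ΣMaps n c _) (trans (*-distribˡ-Σ m c _) (Σ-cong m (λ j → *-distribˡ-ΣMaps n c _))))

  *-distribʳ-ΣMaps : ∀ n {m} c (f : (Fin n → Maybe (Fin m)) → Carrier) →
    ΣMaps n f * c ≡ ΣMaps n (λ p → f p * c)
  *-distribʳ-ΣMaps n c f =
    trans (*-comm _ c) (trans (*-distribˡ-ΣMaps n c f) (ΣMaps-cong n (λ p → *-comm c (f p))))

  ΣMaps-nonneg : ∀ n {m} (f : (Fin n → Maybe (Fin m)) → Carrier) → (∀ p → 0# ≤ f p) → 0# ≤ ΣMaps n f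
  ΣMaps-nonneg zero        f 0≤f = 0≤f _
  ΣMaps-nonneg (suc n) {m} f 0≤f = subst (_≤ ΣMaps (suc n) f) (+-identityʳ 0#)
    (+-mono-≤ (ΣMaps-nonneg n _ (λ p → 0≤f _)) (Σ-nonneg m _ (λ j → ΣMaps-nonneg n _ (λ p → 0≤f _))))

  ΣMaps-pos : ∀ n {m} (f : (Fin n → Maybe (Fin m)) → Carrier) → (∀ p → 0# ≤ f p) →
    (∀ p → (∀ i → p i ≡ nothing) → 0# < f p) → 0# < ΣMaps n f
  ΣMaps-pos zero        f 0≤f 0<f = 0<f _ (λ ())
  ΣMaps-pos (suc n) {m} f 0≤f 0<f = subst (_< ΣMaps (suc n) f) (+-identityʳ 0#) (+-mono-<-≤
    (ΣMaps-pos n _ (λ p → 0≤f _) (λ p p≡∅ → 0<f _ λ { zero → refl ; (suc i) → p≡∅ i }))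
    (Σ-nonneg m _ (λ j → ΣMaps-nonneg n _ (λ p → 0≤f _))))

  -- Recursive on the index (unlike the pointwise updateAt), so that it
  -- follows the recursion of ΣMaps by computation.
  _[_≔_] : ∀ {n} {A : Set} → (Fin n → A) → Fin n → A → (Fin n → A)
  p [ zero  ≔ c ] = c ∷ (λ k → p (suc k))
  p [ suc i ≔ c ] = p zero ∷ (λ k → p (suc k)) [ i ≔ c ]

  ≔-updates : ∀ {n} {A : Set} (p : Fin n → A) i c → (p [ i ≔ c ]) i ≡ c
  ≔-updates p zero    c = refl
  ≔-updates p (suc i) c = ≔-updates (λ k → p (suc k)) i c

  ≔-minimal : ∀ {n} {A : Set} (p : Fin n → A) i c k → k ≢ i → (p [ i ≔ c ]) k ≡ p k
  ≔-minimal p zero    c zero    k≢i = contradiction refl k≢i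
  ≔-minimal p zero    c (suc k) k≢i = refl
  ≔-minimal p (suc i) c zero    k≢i = refl
  ≔-minimal p (suc i) c (suc k) k≢i = ≔-minimal (λ k → p (suc k)) i c k (k≢i ∘ cong suc)

  toMaybe : ∀ {m} → Fin (suc m) → Maybe (Fin m)
  toMaybe zero    = nothing
  toMaybe (suc j) = just j

  ΣMaybe : ∀ m → (Maybe (Fin m) → Carrier) → Carrier
  ΣMaybe m h = Σ (suc m) (h ∘ toMaybe)

  𝟙-nothing : ∀ {m} → Maybe (Fin m) → Carrier
  𝟙-nothing nothing  = 1#
  𝟙-nothing (just _) = 0#

  ΣMaps-split : ∀ n {m} i (f : (Fin n → Maybe (Fin m)) → Carrier) →
    ΣMaps n f ≡ ΣMaps n (λ p → 𝟙-nothing (p i) * ΣMaybe m (λ c → f (p [ i ≔ c ])))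
  ΣMaps-split (suc n) {m} zero f = sym (begin
    ΣMaps n (λ p → 1# * ΣMaybe m (λ c → f (c ∷ p)))
      + Σ m (λ j → ΣMaps n (λ p → 0# * ΣMaybe m (λ c → f (c ∷ p))))
      ≡⟨ cong₂ _+_ (ΣMaps-cong n (λ p → *-identityˡ _))
                   (trans (Σ-cong m (λ j → trans (ΣMaps-cong n (λ p → zeroˡ _)) (ΣMaps-zero n))) (Σ-zero m)) ⟩
    ΣMaps n (λ p → ΣMaybe m (λ c → f (c ∷ p))) + 0#
      ≡⟨ +-identityʳ _ ⟩
    ΣMaps n (λ p → f (nothing ∷ p) + Σ m (λ j → f (just j ∷ p)))
      ≡⟨ trans (ΣMaps-distrib-+ n _ _) (cong (ΣMaps n (λ p → f (nothing ∷ p)) +_) (ΣMaps-Σ-comm n m _)) ⟩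
    ΣMaps (suc n) f ∎)
  ΣMaps-split (suc n) {m} (suc i) f =
    cong₂ _+_ (ΣMaps-split n i _) (Σ-cong m (λ j → ΣMaps-split n i _))

  ⊗-·-assoc : ∀ {n} (A B : Matrix n) v i → ((A ⊗ B) · v) i ≡ (A · (B · v)) i
  ⊗-·-assoc {n} A B v i = begin
    Σ n (λ j → Σ n (λ k → A i k * B k j) * v j)  ≡⟨ Σ-cong n (λ j → *-distribʳ-Σ n (v j) _) ⟩
    Σ n (λ j → Σ n (λ k → A i k * B k j * v j))  ≡⟨ Σ-comm n n _ ⟩
    Σ n (λ k → Σ n (λ j → A i k * B k j * v j))
      ≡⟨ Σ-cong n (λ k → trans (Σ-cong n (λ j → *-assoc _ _ _)) (sym (*-distribˡ-Σ n (A i k) _))) ⟩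
    Σ n (λ k → A i k * (B · v) k)               ∎

  Σ-*-·-transpose : ∀ {n} (u : Fin n → Carrier) (A : Matrix n) v →
    Σ n (λ i → u i * (A · v) i) ≡ Σ n (λ k → Σ n (λ i → A i k * u i) * v k)
  Σ-*-·-transpose {n} u A v = begin
    Σ n (λ i → u i * Σ n (λ k → A i k * v k))    ≡⟨ Σ-cong n (λ i → *-distribˡ-Σ n (u i) _) ⟩
    Σ n (λ i → Σ n (λ k → u i * (A i k * v k)))  ≡⟨ Σ-comm n n _ ⟩
    Σ n (λ k → Σ n (λ i → u i * (A i k * v k)))
      ≡⟨ Σ-cong n (λ k → Σ-cong n (λ i → solve 3 (λ u a v → u :* (a :* v) := a :* u :* v) refl (u i) (A i k) (v k))) ⟩
    Σ n (λ k → Σ n (λ i → A i k * u i * v k))    ≡⟨ Σ-cong n (λ k → sym (*-distribʳ-Σ n (v k) _)) ⟩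
    Σ n (λ k → Σ n (λ i → A i k * u i) * v k)    ∎

  quad-δ : ∀ {n} (y : Fin n → Carrier) → quad δ y ≡ Σ n (λ i → y i * y i)
  quad-δ {n} y = Σ-cong n (λ i → cong (y i *_) (Σ-δ n i y))

  quad-- : ∀ {n} (A B : Matrix n) y → quad (λ i j → A i j - B i j) y ≡ quad A y - quad B y
  quad-- {n} A B y = trans (Σ-cong n per-row) (Σ-distrib-- n _ _)
    where
    per-row : ∀ i → y i * Σ n (λ j → (A i j - B i j) * y j) ≡ y i * (A · y) i - y i * (B · y) i
    per-row i = begin
      y i * Σ n (λ j → (A i j - B i j) * y j)
        ≡⟨ cong (y i *_) (Σ-cong n (λ j → solve 3 (λ a b y → (a :- b) :* y := a :* y :- b :* y) refl (A i j) (B i j) (y j))) ⟩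
      y i * Σ n (λ j → A i j * y j - B i j * y j)  ≡⟨ cong (y i *_) (Σ-distrib-- n _ _) ⟩
      y i * ((A · y) i - (B · y) i)                ≡⟨ solve 3 (λ y a b → y :* (a :- b) := y :* a :- y :* b) refl (y i) _ _ ⟩
      y i * (A · y) i - y i * (B · y) i            ∎

module ParentMaps (F : OrderedField) where
  open Graph F
  open ≡-Reasoning

  IsRoot : ∀ {n} → ParentMap n → Fin n → Set
  IsRoot p x = p x ≡ nothing

  step-root : ∀ {n} (p : ParentMap n) {x} → IsRoot p x → step p x ≡ x
  step-root p {x} x-root with p x
  step-root p x-root | nothing = refl

  step-parent : ∀ {n} (p : ParentMap n) {x y} → p x ≡ just y → step p x ≡ y
  step-parent p {x} px≡y with p x
  step-parent p refl | just _ = refl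

  step-cong : ∀ {n} (p p′ : ParentMap n) x → p x ≡ p′ x → step p x ≡ step p′ x
  step-cong p p′ x px≡p′x with p x | p′ x
  step-cong p p′ x refl | nothing | _ = refl
  step-cong p p′ x refl | just _  | _ = refl

  reach-+ : ∀ {n} (p : ParentMap n) a b x → reach p (a ℕ.+ b) x ≡ reach p b (reach p a x)
  reach-+ p zero    b x = refl
  reach-+ p (suc a) b x = reach-+ p a b (step p x)

  reach-root : ∀ {n} (p : ParentMap n) k {x} → IsRoot p x → reach p k x ≡ x
  reach-root p zero    x-root = refl
  reach-root p (suc k) x-root = trans (cong (reach p k) (step-root p x-root)) (reach-root p k x-root)

  reach-cong : ∀ {n} (p p′ : ParentMap n) → (∀ x → p x ≡ p′ x) → ∀ k x → reach p k x ≡ reach p′ k x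
  reach-cong p p′ p≗p′ zero    x = refl
  reach-cong p p′ p≗p′ (suc k) x = trans (cong (reach p k) (step-cong p p′ x (p≗p′ x))) (reach-cong p p′ p≗p′ k _)

  reach-≤-root : ∀ {n} (p : ParentMap n) {a b} x → a ℕ.≤ b → IsRoot p (reach p a x) → reach p b x ≡ reach p a x
  reach-≤-root p {a} {b} x a≤b root-at-a = begin
    reach p b x                   ≡⟨ cong (λ t → reach p t x) (sym (ℕ.m+[n∸m]≡n a≤b)) ⟩
    reach p (a ℕ.+ (b ℕ.∸ a)) x   ≡⟨ reach-+ p a (b ℕ.∸ a) x ⟩
    reach p (b ℕ.∸ a) (reach p a x) ≡⟨ reach-root p (b ℕ.∸ a) root-at-a ⟩
    reach p a x                   ∎

  reached-roots-unique : ∀ {n} (p : ParentMap n) a b x →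
    IsRoot p (reach p a x) → IsRoot p (reach p b x) → reach p a x ≡ reach p b x
  reached-roots-unique p a b x root-at-a root-at-b with ℕ.≤-total a b
  ... | inj₁ a≤b = sym (reach-≤-root p x a≤b root-at-a)
  ... | inj₂ b≤a = reach-≤-root p x b≤a root-at-b

  ReachesRoots : ∀ {n} → ParentMap n → Set
  ReachesRoots p = ∀ x → ∃[ k ] IsRoot p (reach p k x)

  -- The first n + 1 nodes of the walk from x repeat (pigeonhole), and cutting
  -- out the loop between the repetition gives a shorter walk to the same root.
  root-within-n : ∀ {n} (p : ParentMap n) x k → IsRoot p (reach p k x) → IsRoot p (reach p n x)
  root-within-n {n} p x k = go (suc k) k (ℕ.n<1+n k)
    where
    go : ∀ fuel k → k ℕ.< fuel → IsRoot p (reach p k x) → IsRoot p (reach p n x)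
    go (suc fuel) k (ℕ.s≤s k≤fuel) root-at-k with k ℕ.≤? n
    ... | yes k≤n = subst (IsRoot p) (sym (reach-≤-root p x k≤n root-at-k)) root-at-k
    ... | no  k≰n with Fin.pigeonhole (ℕ.n<1+n n) (λ (t : Fin (suc n)) → reach p (Fin.toℕ t) x)
    ... | a , b , a<b , walk-a≡walk-b = go fuel k′ (ℕ.<-≤-trans k′<k k≤fuel) (subst (IsRoot p) walk-k≡walk-k′ root-at-k)
      where
      A = Fin.toℕ a
      B = Fin.toℕ b
      B≤k : B ℕ.≤ k
      B≤k = ℕ.≤-trans (ℕ.s≤s⁻¹ (Fin.toℕ<n b)) (ℕ.<⇒≤ (ℕ.≰⇒> k≰n))
      k′ = A ℕ.+ (k ℕ.∸ B)
      k′<k : k′ ℕ.< k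
      k′<k = subst (k′ ℕ.<_) (ℕ.m+[n∸m]≡n B≤k) (ℕ.+-monoˡ-< (k ℕ.∸ B) a<b)
      walk-k≡walk-k′ : reach p k x ≡ reach p k′ x
      walk-k≡walk-k′ = begin
        reach p k x                       ≡⟨ cong (λ t → reach p t x) (sym (ℕ.m+[n∸m]≡n B≤k)) ⟩
        reach p (B ℕ.+ (k ℕ.∸ B)) x       ≡⟨ reach-+ p B (k ℕ.∸ B) x ⟩
        reach p (k ℕ.∸ B) (reach p B x)   ≡⟨ cong (reach p (k ℕ.∸ B)) (sym walk-a≡walk-b) ⟩
        reach p (k ℕ.∸ B) (reach p A x)   ≡⟨ sym (reach-+ p A (k ℕ.∸ B) x) ⟩
        reach p k′ x                      ∎

  ReachesRoots⇒Acyclic : ∀ {n} (p : ParentMap n) → ReachesRoots p → Acyclic p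
  ReachesRoots⇒Acyclic p reaches x = root-within-n p x (proj₁ (reaches x)) (proj₂ (reaches x))

  Acyclic-cong : ∀ {n} {p p′ : ParentMap n} → (∀ x → p x ≡ p′ x) → Acyclic p → Acyclic p′
  Acyclic-cong {n} {p} {p′} p≗p′ acyclic x =
    trans (sym (p≗p′ _)) (subst (IsRoot p) (reach-cong p p′ p≗p′ n x) (acyclic x))

  root-cong : ∀ {n} {p p′ : ParentMap n} → (∀ x → p x ≡ p′ x) → ∀ x → root p x ≡ root p′ x
  root-cong {n} {p} {p′} p≗p′ = reach-cong p p′ p≗p′ n

  module Roots {n} (p : ParentMap n) (acyclic : Acyclic p) where

    root-isRoot : ∀ x → IsRoot p (root p x)
    root-isRoot = acyclic

    reached-root : ∀ k x → IsRoot p (reach p k x) → reach p k x ≡ root p x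
    reached-root k x root-at-k = reached-roots-unique p k n x root-at-k (acyclic x)

    root-of-root : ∀ {x} → IsRoot p x → root p x ≡ x
    root-of-root = reach-root p n

    root-step : ∀ x → root p (step p x) ≡ root p x
    root-step x = begin
      reach p n (step p x)   ≡⟨ cong (λ t → reach p t x) (ℕ.+-comm 1 n) ⟩
      reach p (n ℕ.+ 1) x    ≡⟨ reach-+ p n 1 x ⟩
      step p (root p x)      ≡⟨ step-root p (acyclic x) ⟩
      root p x               ∎

  module Rewire {n} (g g′ : ParentMap n) (i : Fin n) (i-root : IsRoot g i)
                (agree : ∀ k → k ≢ i → g′ k ≡ g k) where

    Acyclic-detach : Acyclic g′ → Acyclic g
    Acyclic-detach acyclic′ = ReachesRoots⇒Acyclic g (λ x → walk n x (acyclic′ x))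
      where
      walk : ∀ t x → IsRoot g′ (reach g′ t x) → ∃[ k ] IsRoot g (reach g k x)
      walk t x root′ with x Fin.≟ i
      walk t       x root′ | yes refl = 0 , i-root
      walk zero    x root′ | no  x≢i  = 0 , trans (sym (agree x x≢i)) root′
      walk (suc t) x root′ | no  x≢i
        with walk t (step g x) (subst (λ z → IsRoot g′ (reach g′ t z)) (step-cong g′ g x (agree x x≢i)) root′)
      ... | k , root-at-k = suc k , root-at-k

    module Attach (acyclic : Acyclic g) {m : Fin n} (i↦m : g′ i ≡ just m) where
      open Roots g acyclic

      walk-outside : ∀ t y → root g y ≢ i → reach g′ t y ≡ reach g t y
      walk-outside zero    y r≢i = refl
      walk-outside (suc t) y r≢i = trans (cong (reach g′ t) (step-cong g′ g y (agree y y≢i)))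
                                        (walk-outside t (step g y) (r≢i ∘ trans (sym (root-step y))))
        where
        y≢i : y ≢ i
        y≢i refl = r≢i (root-of-root i-root)

      walk-inside : ∀ t y → reach g t y ≡ i → ∃[ s ] reach g′ s y ≡ m
      walk-inside zero    y y≡i = 1 , trans (cong (step g′) y≡i) (step-parent g′ i↦m)
      walk-inside (suc t) y walk≡i with y Fin.≟ i
      ... | yes refl = 1 , step-parent g′ i↦m
      ... | no  y≢i with walk-inside t (step g y) walk≡i
      ... | s , walk′≡m = suc s , trans (cong (reach g′ s) (step-cong g′ g y (agree y y≢i))) walk′≡m

      module Outside (m-outside : root g m ≢ i) where
        root-outside-reached : ∀ y → root g y ≢ i → IsRoot g′ (reach g′ n y)
        root-outside-reached y r≢i = trans (cong g′ (walk-outside n y r≢i)) (trans (agree _ r≢i) (acyclic y))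

        through-m : ∀ y → root g y ≡ i → ∃[ s ] reach g′ s y ≡ root g m × IsRoot g′ (root g m)
        through-m y r≡i with walk-inside n y r≡i
        ... | s , walk≡m = s ℕ.+ n
                         , trans (reach-+ g′ s n y) (trans (cong (reach g′ n) walk≡m) (walk-outside n m m-outside))
                         , subst (IsRoot g′) (walk-outside n m m-outside) (root-outside-reached m m-outside)

        Acyclic-attach : Acyclic g′
        Acyclic-attach = ReachesRoots⇒Acyclic g′ reaches
          where
          reaches : ReachesRoots g′
          reaches y with root g y Fin.≟ i
          ... | no  r≢i = n , root-outside-reached y r≢i
          ... | yes r≡i with through-m y r≡i
          ... | s , walk≡r , r-root = s , subst (IsRoot g′) (sym walk≡r) r-root

        open Roots g′ Acyclic-attach using () renaming (reached-root to reached-root′)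

        root-attach-outside : ∀ y → root g y ≢ i → root g′ y ≡ root g y
        root-attach-outside y r≢i =
          trans (sym (reached-root′ n y (root-outside-reached y r≢i))) (walk-outside n y r≢i)

        root-attach-inside : ∀ y → root g y ≡ i → root g′ y ≡ root g m
        root-attach-inside y r≡i with through-m y r≡i
        ... | s , walk≡r , r-root = trans (sym (reached-root′ s y (subst (IsRoot g′) (sym walk≡r) r-root))) walk≡r

      cycle-attach : root g m ≡ i → ¬ Acyclic g′
      cycle-attach m-inside acyclic′ = off-root (reach g′ n m) (stays n m m-inside) (acyclic′ m)
        where
        stays : ∀ t y → root g y ≡ i → root g (reach g′ t y) ≡ i
        stays zero    y r≡i = r≡i
        stays (suc t) y r≡i with y Fin.≟ i
        ... | yes refl = stays t _ (subst (λ z → root g z ≡ i) (sym (step-parent g′ i↦m)) m-inside)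
        ... | no  y≢i  = stays t _ (trans (cong (root g) (step-cong g′ g y (agree y y≢i))) (trans (root-step y) r≡i))
        off-root : ∀ y → root g y ≡ i → ¬ IsRoot g′ y
        off-root y r≡i y-root with y Fin.≟ i
        ... | yes refl = contradiction (trans (sym i↦m) y-root) λ ()
        ... | no  y≢i  = y≢i (trans (sym (root-of-root (trans (sym (agree y y≢i)) y-root))) r≡i)

module Laplacian (F : OrderedField) where
  open OrderedField F
  open Graph F
  open OrderedFieldProperties F
  open FiniteSums F
  open ParentMaps F
  open ≡-Reasoning

  module MaximumPrinciple
    (n : ℕ) (W : Matrix n) (W-nonneg : ∀ i j → 0# ≤ W i j) (q : Carrier) (0<q : 0# < q) where

    open Data.List.Extrema ≤-totalOrder using (argmax; f[xs]≤f[argmax])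

    -- v lies in the kernel of q I + L
    Harmonic : (Fin n → Carrier) → Set
    Harmonic v = ∀ i → (q + degree W i) * v i ≡ Σ n (λ k → W i k * v k)

    ≤-argmax : ∀ (v : Fin n → Carrier) i k → v k ≤ v (argmax v i (allFin n))
    ≤-argmax v i k = All.lookup (f[xs]≤f[argmax] i (allFin n)) (∈-allFin k)

    -- At a maximum, (q + dᵢ) vᵢ = Σₖ Wᵢₖ vₖ ≤ dᵢ vᵢ because W ≥ 0, hence q vᵢ ≤ 0.
    harmonic-max≤0 : ∀ {v} → Harmonic v → ∀ i → (∀ k → v k ≤ v i) → v i ≤ 0#
    harmonic-max≤0 {v} harmonic i v≤vᵢ = pos*x≤0⇒x≤0 0<q (subst₂ _≤_
      (solve 3 (λ q d x → (q :+ d) :* x :- d :* x := q :* x) refl q (degree W i) (v i))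
      (solve 2 (λ d x → d :* x :- d :* x := :0) refl (degree W i) (v i))
      (+-monoˡ-≤ (- (degree W i * v i)) (subst₂ _≤_ (sym (harmonic i)) (sym (*-distribʳ-Σ n (v i) (W i)))
        (Σ-mono-≤ n _ _ (λ k → *-monoˡ-≤-nonneg (W-nonneg i k) (v≤vᵢ k))))))

    harmonic-neg : ∀ {v} → Harmonic v → Harmonic (λ k → - v k)
    harmonic-neg {v} harmonic i = begin
      (q + degree W i) * - v i       ≡⟨ sym (-‿distribʳ-* _ _) ⟩
      - ((q + degree W i) * v i)     ≡⟨ cong -_ (harmonic i) ⟩
      - Σ n (λ k → W i k * v k)      ≡⟨ solve 1 (λ x → :- x := :- :1 :* x) refl _ ⟩
      - 1# * Σ n (λ k → W i k * v k) ≡⟨ *-distribˡ-Σ n (- 1#) _ ⟩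
      Σ n (λ k → - 1# * (W i k * v k)) ≡⟨ Σ-cong n (λ k → solve 2 (λ w x → :- :1 :* (w :* x) := w :* :- x) refl (W i k) (v k)) ⟩
      Σ n (λ k → W i k * - v k)      ∎

    harmonic≤0 : ∀ {v} → Harmonic v → ∀ i → v i ≤ 0#
    harmonic≤0 {v} harmonic i = ≤-trans (≤-argmax v i i) (harmonic-max≤0 harmonic _ (≤-argmax v i))

    harmonic⇒zero : ∀ {v} → Harmonic v → ∀ i → v i ≡ 0#
    harmonic⇒zero {v} harmonic i = ≤-antisym (harmonic≤0 harmonic i)
      (-x≤0⇒0≤x (harmonic≤0 (harmonic-neg harmonic) i))

  module ForestMeasure
    (n : ℕ) (W : Matrix n) (W-nonneg : ∀ i j → 0# ≤ W i j) (q : Carrier) (0<q : 0# < q) where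

    w : ParentMap n → Carrier
    w = forestWeight q W

    weight : ParentMap n → Carrier
    weight p = Π n (λ k → nodeWeight q W k (p k))

    w-forest : ∀ p → IsForest W p → w p ≡ weight p
    w-forest p forest with isForest? W p
    ... | yes _         = refl
    ... | no  ¬forest   = contradiction forest ¬forest

    w-nonforest : ∀ p → ¬ IsForest W p → w p ≡ 0#
    w-nonforest p ¬forest with isForest? W p
    ... | yes forest = contradiction forest ¬forest
    ... | no  _      = refl

    w-nonneg : ∀ p → 0# ≤ w p
    w-nonneg p with isForest? W p
    ... | yes _ = Π-nonneg n _ (λ k → nodeWeight-nonneg k (p k))
      where
      nodeWeight-nonneg : ∀ k c → 0# ≤ nodeWeight q W k c
      nodeWeight-nonneg k nothing  = inj₁ 0<q
      nodeWeight-nonneg k (just l) = W-nonneg k l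
    ... | no  _ = ≤-refl

    IsForest-cong : ∀ {p p′} → (∀ k → p k ≡ p′ k) → IsForest W p → IsForest W p′
    IsForest-cong p≗p′ (acyclic , edges) =
      Acyclic-cong p≗p′ acyclic , λ k → subst (EdgeOK W k) (p≗p′ k) (edges k)

    w-cong : ∀ {p p′} → (∀ k → p k ≡ p′ k) → w p ≡ w p′
    w-cong {p} {p′} p≗p′ with isForest? W p
    ... | yes forest = trans (Π-cong n (λ k → cong (nodeWeight q W k) (p≗p′ k)))
                              (sym (w-forest p′ (IsForest-cong p≗p′ forest)))
    ... | no ¬forest = sym (w-nonforest p′ (¬forest ∘ IsForest-cong (sym ∘ p≗p′)))

    Z-pos : 0# < Z q W
    Z-pos = ΣMaps-pos n w w-nonneg λ p p≡∅ →
      subst (0# <_) (sym (w-forest p (forest p p≡∅)))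
        (Π-pos n _ (λ k → subst (λ c → 0# < nodeWeight q W k c) (sym (p≡∅ k)) 0<q))
      where
      forest : ∀ p → (∀ k → p k ≡ nothing) → IsForest W p
      forest p p≡∅ = (λ _ → p≡∅ _) , (λ k → subst (EdgeOK W k) (sym (p≡∅ k)) tt)

    Z*Z⁻¹≡1 : Z q W * Z q W ⁻¹ ≡ 1#
    Z*Z⁻¹≡1 = ⁻¹-inverse (Z q W) (pos⇒≢0 Z-pos)

    𝔼-cong : ∀ {f g} → (∀ p → f p ≡ g p) → 𝔼 q W f ≡ 𝔼 q W g
    𝔼-cong f≗g = cong (_* Z q W ⁻¹) (ΣMaps-cong n (λ p → cong (w p *_) (f≗g p)))

    𝔼-const : ∀ c → 𝔼 q W (λ _ → c) ≡ c
    𝔼-const c = begin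
      ΣMaps n (λ p → w p * c) * Z q W ⁻¹  ≡⟨ cong (_* Z q W ⁻¹) (sym (*-distribʳ-ΣMaps n c w)) ⟩
      Z q W * c * Z q W ⁻¹                ≡⟨ solve 3 (λ z c u → z :* c :* u := c :* (z :* u)) refl (Z q W) c _ ⟩
      c * (Z q W * Z q W ⁻¹)              ≡⟨ trans (cong (c *_) Z*Z⁻¹≡1) (*-identityʳ c) ⟩
      c                                   ∎

    𝔼-+ : ∀ f g → 𝔼 q W (λ p → f p + g p) ≡ 𝔼 q W f + 𝔼 q W g
    𝔼-+ f g = trans
      (cong (_* Z q W ⁻¹) (trans (ΣMaps-cong n (λ p → distribˡ (w p) (f p) (g p))) (ΣMaps-distrib-+ n _ _)))
      (distribʳ _ _ _)

    𝔼-scale : ∀ c f → 𝔼 q W (λ p → c * f p) ≡ c * 𝔼 q W f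
    𝔼-scale c f = trans
      (cong (_* Z q W ⁻¹) (trans (ΣMaps-cong n (λ p → solve 3 (λ w c x → w :* (c :* x) := c :* (w :* x)) refl (w p) c (f p)))
                                 (sym (*-distribˡ-ΣMaps n c _))))
      (*-assoc c _ _)

    𝔼-Σ : ∀ m (h : ParentMap n → Fin m → Carrier) →
      𝔼 q W (λ p → Σ m (h p)) ≡ Σ m (λ i → 𝔼 q W (λ p → h p i))
    𝔼-Σ m h = begin
      ΣMaps n (λ p → w p * Σ m (h p)) * Z q W ⁻¹
        ≡⟨ cong (_* Z q W ⁻¹) (trans (ΣMaps-cong n (λ p → *-distribˡ-Σ m (w p) (h p))) (ΣMaps-Σ-comm n m _)) ⟩
      Σ m (λ i → ΣMaps n (λ p → w p * h p i)) * Z q W ⁻¹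
        ≡⟨ *-distribʳ-Σ m _ _ ⟩
      Σ m (λ i → ΣMaps n (λ p → w p * h p i) * Z q W ⁻¹) ∎

    var-formula : ∀ f → var q W f ≡ 𝔼 q W (λ p → f p * f p) - 𝔼 q W f * 𝔼 q W f
    var-formula f = begin
      𝔼 q W (λ p → (f p - μ) * (f p - μ))
        ≡⟨ 𝔼-cong (λ p → solve 2 (λ x m → (x :- m) :* (x :- m) := x :* x :+ (:- (m :+ m) :* x :+ m :* m)) refl (f p) μ) ⟩
      𝔼 q W (λ p → f p * f p + (- (μ + μ) * f p + μ * μ))
        ≡⟨ trans (𝔼-+ _ _) (cong (𝔼 q W (λ p → f p * f p) +_) (trans (𝔼-+ _ _) (cong₂ _+_ (𝔼-scale _ f) (𝔼-const _)))) ⟩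
      𝔼 q W (λ p → f p * f p) + (- (μ + μ) * μ + μ * μ)
        ≡⟨ cong (𝔼 q W (λ p → f p * f p) +_) (solve 1 (λ m → :- (m :+ m) :* m :+ m :* m := :- (m :* m)) refl μ) ⟩
      𝔼 q W (λ p → f p * f p) - μ * μ ∎
      where
      μ = 𝔼 q W f

    d : Fin n → Carrier
    d = degree W

    -- The two sides of row i of (q I + L) M = q Z I as sums over parent maps.
    -- They already agree after summing over the parent of i alone.
    module Resample (i j : Fin n) where

      lhs-summand rhs-summand : ParentMap n → Carrier
      lhs-summand p = (q + d i) * (w p * δ (root p i) j)
      rhs-summand p = w p * (q * δ i j + Σ n (λ k → W i k * δ (root p k) j))

      module AtRoot (g : ParentMap n) (i-root : IsRoot g i) where

        g[_] : Maybe (Fin n) → ParentMap n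
        g[ c ] = g [ i ≔ c ]

        module Rewired (c : Maybe (Fin n)) = Rewire g g[ c ] i i-root (≔-minimal g i c)

        g[nothing]≗g : ∀ k → g[ nothing ] k ≡ g k
        g[nothing]≗g k with k Fin.≟ i
        ... | yes refl = trans (≔-updates g i nothing) (sym i-root)
        ... | no  k≢i  = ≔-minimal g i nothing k k≢i

        resample-nonforest : ¬ IsForest W g → ΣMaybe n (lhs-summand ∘ g[_]) ≡ ΣMaybe n (rhs-summand ∘ g[_])
        resample-nonforest ¬forest = Σ-cong (suc n) (λ c → trans (lhs≡0 (toMaybe c)) (sym (rhs≡0 (toMaybe c))))
          where
          w≡0 : ∀ c → w g[ c ] ≡ 0#
          w≡0 c = w-nonforest g[ c ] λ (acyclic , edges) → ¬forest (Rewired.Acyclic-detach c acyclic , edges′ c edges)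
            where
            edges′ : ∀ c → (∀ k → EdgeOK W k (g[ c ] k)) → ∀ k → EdgeOK W k (g k)
            edges′ c edges k with k Fin.≟ i
            ... | yes refl = subst (EdgeOK W k) (sym i-root) tt
            ... | no  k≢i  = subst (EdgeOK W k) (≔-minimal g i c k k≢i) (edges k)
          lhs≡0 : ∀ c → lhs-summand g[ c ] ≡ 0#
          lhs≡0 c = trans (cong (λ t → (q + d i) * (t * δ (root g[ c ] i) j)) (w≡0 c))
                          (solve 2 (λ a b → a :* (:0 :* b) := :0) refl _ _)
          rhs≡0 : ∀ c → rhs-summand g[ c ] ≡ 0#
          rhs≡0 c = trans (cong (_* (q * δ i j + Σ n (λ k → W i k * δ (root g[ c ] k) j))) (w≡0 c)) (zeroˡ _)

        module Forest (forest : IsForest W g) where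
          open Roots g (proj₁ forest)

          -- e k = 1 iff k lies in the tree of i.  Giving i the parent c multiplies
          -- the weight by κ c / q, and the tree of i then takes a root r with
          -- δ r j = τ c, so that δ (root k) j becomes X (τ c) k.
          e : Fin n → Carrier
          e k = δ (root g k) i

          X : Carrier → Fin n → Carrier
          X t k = e k * t + (1# - e k) * δ (root g k) j

          κ τ : Maybe (Fin n) → Carrier
          κ nothing  = q
          κ (just m) = (1# - e m) * W i m
          τ nothing  = δ i j
          τ (just m) = δ (root g m) j

          e-inside : ∀ {k} → root g k ≡ i → e k ≡ 1#
          e-inside = δ-≡

          e-outside : ∀ {k} → root g k ≢ i → e k ≡ 0#
          e-outside = δ-≢

          X-inside : ∀ t {k} → root g k ≡ i → X t k ≡ t
          X-inside t {k} r≡i = trans (cong (λ x → x * t + (1# - x) * δ (root g k) j) (e-inside r≡i))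
            (solve 2 (λ t y → :1 :* t :+ (:1 :- :1) :* y := t) refl t _)

          X-outside : ∀ t {k} → root g k ≢ i → X t k ≡ δ (root g k) j
          X-outside t {k} r≢i = trans (cong (λ x → x * t + (1# - x) * δ (root g k) j) (e-outside r≢i))
            (solve 2 (λ t y → :0 :* t :+ (:1 :- :0) :* y := y) refl t _)

          split-tree : ∀ {A : Set} k → (root g k ≡ i → A) → (root g k ≢ i → A) → A
          split-tree k inside outside = [ inside , outside ]′ (toSum (root g k Fin.≟ i))

          δ-root≡X : ∀ k → δ (root g k) j ≡ X (δ i j) k
          δ-root≡X k = split-tree k
            (λ r≡i → trans (cong (λ r → δ r j) r≡i) (sym (X-inside (δ i j) r≡i)))
            (λ r≢i → sym (X-outside (δ i j) r≢i))

          root-term : ∀ c k → IsForest W g[ c ] → δ (root g[ c ] k) j ≡ X (τ c) k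
          root-term nothing  k _ = trans (cong (λ r → δ r j) (root-cong g[nothing]≗g k)) (δ-root≡X k)
          root-term (just m) k (acyclic′ , _) = split-tree m
            (λ m-inside → contradiction acyclic′ (cycle-attach m-inside))
            (λ m-outside → let open Outside m-outside in split-tree k
              (λ r≡i → trans (cong (λ r → δ r j) (root-attach-inside k r≡i)) (sym (X-inside _ r≡i)))
              (λ r≢i → trans (cong (λ r → δ r j) (root-attach-outside k r≢i)) (sym (X-outside _ r≢i))))
            where
            open Rewired (just m)
            open Attach (proj₁ forest) (≔-updates g i (just m))

          q*w : ∀ c → q * w g[ c ] ≡ κ c * w g
          q*w nothing  = cong (q *_) (w-cong g[nothing]≗g)
          q*w (just m) = split-tree m inside outside
            where
            open Rewired (just m)
            open Attach (proj₁ forest) (≔-updates g i (just m))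
            g′ = g[ just m ]

            vanishing : w g′ ≡ 0# → (1# - e m) * W i m ≡ 0# → q * w g′ ≡ κ (just m) * w g
            vanishing w≡0 κ≡0 = trans (cong (q *_) w≡0) (trans (zeroʳ q) (sym (trans (cong (_* w g) κ≡0) (zeroˡ (w g)))))

            inside : root g m ≡ i → q * w g′ ≡ κ (just m) * w g
            inside m-inside = vanishing (w-nonforest g′ (cycle-attach m-inside ∘ proj₁))
              (trans (cong (λ x → (1# - x) * W i m) (e-inside m-inside)) (solve 1 (λ x → (:1 :- :1) :* x := :0) refl (W i m)))

            outside : root g m ≢ i → q * w g′ ≡ κ (just m) * w g
            outside m-outside with W-nonneg i m
            ... | inj₂ 0≡W = vanishing
              (w-nonforest g′ λ (_ , edges) →
                <-irrefl (subst (0# <_) (sym 0≡W) (subst (EdgeOK W i) (≔-updates g i (just m)) (edges i))))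
              (trans (cong ((1# - e m) *_) (sym 0≡W)) (zeroʳ _))
            ... | inj₁ 0<W = begin
              q * w g′                                  ≡⟨ cong₂ _*_ (cong (nodeWeight q W i) (sym i-root)) (w-forest g′ forest′) ⟩
              nodeWeight q W i (g i) * weight g′        ≡⟨ Π-exchange n (λ k → nodeWeight q W k (g k)) (λ k → nodeWeight q W k (g′ k)) i
                                                             (λ k k≢i → cong (nodeWeight q W k) (sym (≔-minimal g i (just m) k k≢i))) ⟩
              nodeWeight q W i (g′ i) * weight g        ≡⟨ cong₂ (λ c x → nodeWeight q W i c * x) (≔-updates g i (just m)) (sym (w-forest g forest)) ⟩
              W i m * w g                               ≡⟨ cong (_* w g) (solve 1 (λ x → x := (:1 :- :0) :* x) refl (W i m)) ⟩
              (1# - 0#) * W i m * w g                   ≡⟨ cong (λ x → (1# - x) * W i m * w g) (sym (e-outside m-outside)) ⟩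
              κ (just m) * w g                          ∎
              where
              forest′ : IsForest W g′
              forest′ = Outside.Acyclic-attach m-outside , edges′
                where
                edges′ : ∀ k → EdgeOK W k (g′ k)
                edges′ k with k Fin.≟ i
                ... | yes refl = subst (EdgeOK W k) (sym (≔-updates g i (just m))) 0<W
                ... | no  k≢i  = subst (EdgeOK W k) (sym (≔-minimal g i (just m) k k≢i)) (proj₂ forest k)

          q*w*root : ∀ c k → q * w g[ c ] * δ (root g[ c ] k) j ≡ κ c * w g * X (τ c) k
          q*w*root c k = [ (λ forest′ → cong₂ _*_ (q*w c) (root-term c k forest′)) , nonforest ]′ (toSum (isForest? W g[ c ]))
            where
            nonforest : ¬ IsForest W g[ c ] → q * w g[ c ] * δ (root g[ c ] k) j ≡ κ c * w g * X (τ c) k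
            nonforest ¬forest′ = begin
              q * w g[ c ] * δ (root g[ c ] k) j  ≡⟨ cong (λ x → q * x * δ (root g[ c ] k) j) w≡0 ⟩
              q * 0# * δ (root g[ c ] k) j        ≡⟨ solve 3 (λ q a b → q :* :0 :* a := q :* :0 :* b) refl q _ (X (τ c) k) ⟩
              q * 0# * X (τ c) k                  ≡⟨ cong (λ x → q * x * X (τ c) k) (sym w≡0) ⟩
              q * w g[ c ] * X (τ c) k            ≡⟨ cong (_* X (τ c) k) (q*w c) ⟩
              κ c * w g * X (τ c) k               ∎
              where
              w≡0 : w g[ c ] ≡ 0#
              w≡0 = w-nonforest g[ c ] ¬forest′

          a T : Carrier
          a = Σ n (λ k → W i k * e k)
          T = ΣMaybe n (λ c → κ c * τ c)

          degree-split : d i ≡ a + Σ n (κ ∘ just)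
          degree-split = trans
            (Σ-cong n (λ k → solve 2 (λ w e → w := w :* e :+ (:1 :- e) :* w) refl (W i k) (e k)))
            (Σ-distrib-+ n _ _)

          Σ-W-X : ∀ t → Σ n (λ k → W i k * X t k) ≡ a * t + Σ n (λ m → κ (just m) * τ (just m))
          Σ-W-X t = begin
            Σ n (λ k → W i k * X t k)
              ≡⟨ Σ-cong n (λ k → solve 4 (λ w e t r → w :* (e :* t :+ (:1 :- e) :* r) := w :* e :* t :+ (:1 :- e) :* w :* r)
                                           refl (W i k) (e k) t (δ (root g k) j)) ⟩
            Σ n (λ k → W i k * e k * t + κ (just k) * τ (just k))
              ≡⟨ Σ-distrib-+ n _ _ ⟩
            Σ n (λ k → W i k * e k * t) + Σ n (λ m → κ (just m) * τ (just m))
              ≡⟨ cong (_+ Σ n (λ m → κ (just m) * τ (just m))) (sym (*-distribʳ-Σ n t _)) ⟩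
            a * t + Σ n (λ m → κ (just m) * τ (just m)) ∎

          q*lhs : ∀ c → q * lhs-summand g[ c ] ≡ (q + d i) * w g * (κ c * τ c)
          q*lhs c = begin
            q * ((q + d i) * (w g[ c ] * δ (root g[ c ] i) j))
              ≡⟨ solve 4 (λ q u v x → q :* (u :* (v :* x)) := u :* (q :* v :* x)) refl q (q + d i) (w g[ c ]) _ ⟩
            (q + d i) * (q * w g[ c ] * δ (root g[ c ] i) j)
              ≡⟨ cong ((q + d i) *_) (q*w*root c i) ⟩
            (q + d i) * (κ c * w g * X (τ c) i)
              ≡⟨ cong (λ x → (q + d i) * (κ c * w g * x)) (X-inside (τ c) (root-of-root i-root)) ⟩
            (q + d i) * (κ c * w g * τ c)
              ≡⟨ solve 4 (λ u k p t → u :* (k :* p :* t) := u :* p :* (k :* t)) refl (q + d i) (κ c) (w g) (τ c) ⟩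
            (q + d i) * w g * (κ c * τ c) ∎

          q*rhs : ∀ c → q * rhs-summand g[ c ] ≡ w g * (κ c * T + a * (κ c * τ c))
          q*rhs c = begin
            q * (w g[ c ] * (q * δ i j + Σ n (λ k → W i k * δ (root g[ c ] k) j)))
              ≡⟨ solve 4 (λ q v x s → q :* (v :* (q :* x :+ s)) := q :* v :* (q :* x) :+ q :* v :* s) refl q (w g[ c ]) (δ i j) _ ⟩
            q * w g[ c ] * (q * δ i j) + q * w g[ c ] * Σ n (λ k → W i k * δ (root g[ c ] k) j)
              ≡⟨ cong₂ (λ x y → x * (q * δ i j) + y) (q*w c) (*-distribˡ-Σ n _ _) ⟩
            κ c * w g * (q * δ i j) + Σ n (λ k → q * w g[ c ] * (W i k * δ (root g[ c ] k) j))
              ≡⟨ cong (κ c * w g * (q * δ i j) +_) (Σ-cong n λ k → trans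
                   (solve 3 (λ v w r → v :* (w :* r) := w :* (v :* r)) refl (q * w g[ c ]) (W i k) _)
                   (cong (W i k *_) (q*w*root c k))) ⟩
            κ c * w g * (q * δ i j) + Σ n (λ k → W i k * (κ c * w g * X (τ c) k))
              ≡⟨ cong (κ c * w g * (q * δ i j) +_) (trans
                   (Σ-cong n λ k → solve 3 (λ w u x → w :* (u :* x) := u :* (w :* x)) refl (W i k) (κ c * w g) _)
                   (sym (*-distribˡ-Σ n _ _))) ⟩
            κ c * w g * (q * δ i j) + κ c * w g * Σ n (λ k → W i k * X (τ c) k)
              ≡⟨ cong (λ x → κ c * w g * (q * δ i j) + κ c * w g * x) (Σ-W-X (τ c)) ⟩
            κ c * w g * (q * δ i j) + κ c * w g * (a * τ c + Σ n (λ m → κ (just m) * τ (just m)))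
              ≡⟨ solve 6 (λ k p x a t b → k :* p :* x :+ k :* p :* (a :* t :+ b) := p :* (k :* (x :+ b) :+ a :* (k :* t)))
                   refl (κ c) (w g) (q * δ i j) a (τ c) _ ⟩
            w g * (κ c * T + a * (κ c * τ c)) ∎

          resample-forest : ΣMaybe n (lhs-summand ∘ g[_]) ≡ ΣMaybe n (rhs-summand ∘ g[_])
          resample-forest = *-cancelˡ (pos⇒≢0 0<q) (begin
            q * ΣMaybe n (lhs-summand ∘ g[_])
              ≡⟨ trans (*-distribˡ-Σ (suc n) q (lhs-summand ∘ g[_] ∘ toMaybe)) (Σ-cong (suc n) (q*lhs ∘ toMaybe)) ⟩
            Σ (suc n) (λ c → (q + d i) * w g * κτ c)
              ≡⟨ sym (*-distribˡ-Σ (suc n) ((q + d i) * w g) κτ) ⟩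
            (q + d i) * w g * T
              ≡⟨ cong (λ x → (q + x) * w g * T) degree-split ⟩
            (q + (a + Σ n (κ ∘ just))) * w g * T
              ≡⟨ solve 5 (λ q a s p t → (q :+ (a :+ s)) :* p :* t := p :* ((q :+ s) :* t :+ a :* t)) refl q a _ (w g) T ⟩
            w g * (ΣMaybe n κ * T + a * T)
              ≡⟨ cong (w g *_) (cong₂ _+_ (*-distribʳ-Σ (suc n) T (κ ∘ toMaybe)) (*-distribˡ-Σ (suc n) a κτ)) ⟩
            w g * (Σ (suc n) (λ c → κ (toMaybe c) * T) + Σ (suc n) (λ c → a * κτ c))
              ≡⟨ cong (w g *_) (sym (Σ-distrib-+ (suc n) (λ c → κ (toMaybe c) * T) (λ c → a * κτ c))) ⟩
            w g * Σ (suc n) (λ c → κ (toMaybe c) * T + a * κτ c)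
              ≡⟨ *-distribˡ-Σ (suc n) (w g) (λ c → κ (toMaybe c) * T + a * κτ c) ⟩
            Σ (suc n) (λ c → w g * (κ (toMaybe c) * T + a * κτ c))
              ≡⟨ sym (trans (*-distribˡ-Σ (suc n) q (rhs-summand ∘ g[_] ∘ toMaybe)) (Σ-cong (suc n) (q*rhs ∘ toMaybe))) ⟩
            q * ΣMaybe n (rhs-summand ∘ g[_]) ∎)
            where
            κτ : Fin (suc n) → Carrier
            κτ c = κ (toMaybe c) * τ (toMaybe c)

      resample : ∀ g → IsRoot g i →
        ΣMaybe n (λ c → lhs-summand (g [ i ≔ c ])) ≡ ΣMaybe n (λ c → rhs-summand (g [ i ≔ c ]))
      resample g i-root = [ Forest.resample-forest , resample-nonforest ]′ (toSum (isForest? W g))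
        where open AtRoot g i-root

      resample-split : ∀ g → 𝟙-nothing (g i) * ΣMaybe n (λ c → lhs-summand (g [ i ≔ c ]))
                           ≡ 𝟙-nothing (g i) * ΣMaybe n (λ c → rhs-summand (g [ i ≔ c ]))
      resample-split g with g i in g-i
      ... | nothing = cong (1# *_) (resample g g-i)
      ... | just _  = trans (zeroˡ _) (sym (zeroˡ _))

    M : Matrix n
    M i j = ΣMaps n (λ p → w p * δ (root p i) j)

    M-equation : ∀ i j → (q + d i) * M i j ≡ q * δ i j * Z q W + Σ n (λ k → W i k * M k j)
    M-equation i j = begin
      (q + d i) * M i j
        ≡⟨ *-distribˡ-ΣMaps n (q + d i) _ ⟩
      ΣMaps n lhs-summand
        ≡⟨ ΣMaps-split n i lhs-summand ⟩
      ΣMaps n (λ g → 𝟙-nothing (g i) * ΣMaybe n (λ c → lhs-summand (g [ i ≔ c ])))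
        ≡⟨ ΣMaps-cong n resample-split ⟩
      ΣMaps n (λ g → 𝟙-nothing (g i) * ΣMaybe n (λ c → rhs-summand (g [ i ≔ c ])))
        ≡⟨ sym (ΣMaps-split n i rhs-summand) ⟩
      ΣMaps n rhs-summand
        ≡⟨ ΣMaps-cong n (λ p → trans
             (solve 3 (λ v x s → v :* (x :+ s) := x :* v :+ v :* s) refl (w p) (q * δ i j) _)
             (cong (q * δ i j * w p +_) (trans (*-distribˡ-Σ n (w p) _)
               (Σ-cong n (λ k → solve 3 (λ v x r → v :* (x :* r) := x :* (v :* r)) refl (w p) (W i k) _))))) ⟩
      ΣMaps n (λ p → q * δ i j * w p + Σ n (λ k → W i k * (w p * δ (root p k) j)))
        ≡⟨ ΣMaps-distrib-+ n _ _ ⟩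
      ΣMaps n (λ p → q * δ i j * w p) + ΣMaps n (λ p → Σ n (λ k → W i k * (w p * δ (root p k) j)))
        ≡⟨ cong₂ _+_ (sym (*-distribˡ-ΣMaps n _ w))
             (trans (ΣMaps-Σ-comm n n _) (Σ-cong n (λ k → sym (*-distribˡ-ΣMaps n (W i k) _)))) ⟩
      q * δ i j * Z q W + Σ n (λ k → W i k * M k j) ∎
      where open Resample i j

  module Regularisation
    (n : ℕ) (W : Matrix n) (W-sym : ∀ i j → W i j ≡ W j i) (W-nonneg : ∀ i j → 0# ≤ W i j)
    (q : Carrier) (0<q : 0# < q) (K : Matrix n)
    (K-inverse : ∀ i j → ((λ a b → q * δ a b + laplacian W a b) ⊗ K) i j ≡ q * δ i j) where

    open ForestMeasure n W W-nonneg q 0<q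
    open MaximumPrinciple n W W-nonneg q 0<q

    A : Matrix n
    A a b = q * δ a b + laplacian W a b

    K-equation : ∀ i j → (q + d i) * K i j ≡ q * δ i j + Σ n (λ k → W i k * K k j)
    K-equation i j = begin
      (q + d i) * K i j                                      ≡⟨ solve 2 (λ x s → x := x :- s :+ s) refl _ S ⟩
      (q + d i) * K i j - S + S                              ≡⟨ cong (λ x → x - S + S) (sym (Σ-δ n i (λ k → (q + d i) * K k j))) ⟩
      Σ n (λ k → δ i k * ((q + d i) * K k j)) - S + S        ≡⟨ cong (_+ S) (sym (Σ-distrib-- n _ _)) ⟩
      Σ n (λ k → δ i k * ((q + d i) * K k j) - W i k * K k j) + S
        ≡⟨ cong (_+ S) (Σ-cong n (λ k → solve 5 (λ x q d w y → x :* ((q :+ d) :* y) :- w :* y := (q :* x :+ (x :* d :- w)) :* y)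
                                                  refl (δ i k) q (d i) (W i k) (K k j))) ⟩
      (A ⊗ K) i j + S                                        ≡⟨ cong (_+ S) (K-inverse i j) ⟩
      q * δ i j + S                                          ∎
      where
      S = Σ n (λ k → W i k * K k j)

    M≡Z*K : ∀ i j → M i j ≡ Z q W * K i j
    M≡Z*K i j = trans (solve 2 (λ m z → m := m :- z :+ z) refl (M i j) (Z q W * K i j))
                      (trans (cong (_+ Z q W * K i j) (harmonic⇒zero harmonic i)) (+-identityˡ _))
      where
      harmonic : Harmonic (λ a → M a j - Z q W * K a j)
      harmonic i = begin
        (q + d i) * (M i j - Z q W * K i j)
          ≡⟨ solve 4 (λ c m z k → c :* (m :- z :* k) := c :* m :- z :* (c :* k)) refl (q + d i) (M i j) (Z q W) (K i j) ⟩
        (q + d i) * M i j - Z q W * ((q + d i) * K i j)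
          ≡⟨ cong₂ (λ x y → x - Z q W * y) (M-equation i j) (K-equation i j) ⟩
        q * δ i j * Z q W + Σ n (λ k → W i k * M k j) - Z q W * (q * δ i j + Σ n (λ k → W i k * K k j))
          ≡⟨ solve 4 (λ x z s t → x :* z :+ s :- z :* (x :+ t) := s :- z :* t) refl (q * δ i j) (Z q W) _ _ ⟩
        Σ n (λ k → W i k * M k j) - Z q W * Σ n (λ k → W i k * K k j)
          ≡⟨ cong (λ x → Σ n (λ k → W i k * M k j) - x) (trans (*-distribˡ-Σ n (Z q W) _)
               (Σ-cong n (λ k → solve 3 (λ z w x → z :* (w :* x) := w :* (z :* x)) refl (Z q W) (W i k) (K k j)))) ⟩
        Σ n (λ k → W i k * M k j) - Σ n (λ k → W i k * (Z q W * K k j))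
          ≡⟨ sym (Σ-distrib-- n _ _) ⟩
        Σ n (λ k → W i k * M k j - W i k * (Z q W * K k j))
          ≡⟨ Σ-cong n (λ k → solve 3 (λ w m x → w :* m :- w :* x := w :* (m :- x)) refl (W i k) (M k j) _) ⟩
        Σ n (λ k → W i k * (M k j - Z q W * K k j)) ∎

    𝔼-root : ∀ (y : Fin n → Carrier) i → 𝔼 q W (λ p → y (root p i)) ≡ (K · y) i
    𝔼-root y i = begin
      ΣMaps n (λ p → w p * y (root p i)) * Z q W ⁻¹
        ≡⟨ cong (_* Z q W ⁻¹) unnormalised ⟩
      Z q W * (K · y) i * Z q W ⁻¹
        ≡⟨ solve 3 (λ z x u → z :* x :* u := x :* (z :* u)) refl (Z q W) _ _ ⟩
      (K · y) i * (Z q W * Z q W ⁻¹)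
        ≡⟨ trans (cong ((K · y) i *_) Z*Z⁻¹≡1) (*-identityʳ _) ⟩
      (K · y) i ∎
      where
      unnormalised : ΣMaps n (λ p → w p * y (root p i)) ≡ Z q W * (K · y) i
      unnormalised = begin
        ΣMaps n (λ p → w p * y (root p i))
          ≡⟨ ΣMaps-cong n (λ p → cong (w p *_) (sym (Σ-δ n (root p i) y))) ⟩
        ΣMaps n (λ p → w p * Σ n (λ j → δ (root p i) j * y j))
          ≡⟨ ΣMaps-cong n (λ p → trans (*-distribˡ-Σ n (w p) _) (Σ-cong n (λ j → sym (*-assoc _ _ _)))) ⟩
        ΣMaps n (λ p → Σ n (λ j → w p * δ (root p i) j * y j))
          ≡⟨ ΣMaps-Σ-comm n n _ ⟩
        Σ n (λ j → ΣMaps n (λ p → w p * δ (root p i) j * y j))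
          ≡⟨ Σ-cong n (λ j → sym (*-distribʳ-ΣMaps n (y j) _)) ⟩
        Σ n (λ j → M i j * y j)
          ≡⟨ Σ-cong n (λ j → trans (cong (_* y j) (M≡Z*K i j)) (*-assoc _ _ _)) ⟩
        Σ n (λ j → Z q W * (K i j * y j))
          ≡⟨ sym (*-distribˡ-Σ n (Z q W) _) ⟩
        Z q W * (K · y) i ∎

    K-rowsum : ∀ i → Σ n (K i) ≡ 1#
    K-rowsum i = begin
      Σ n (K i)                    ≡⟨ Σ-cong n (λ j → sym (*-identityʳ (K i j))) ⟩
      (K · (λ _ → 1#)) i           ≡⟨ sym (𝔼-root (λ _ → 1#) i) ⟩
      𝔼 q W (λ _ → 1#)             ≡⟨ 𝔼-const 1# ⟩
      1#                           ∎

    A-sym : ∀ a b → A a b ≡ A b a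
    A-sym a b = [ (λ { refl → refl }) , off-diagonal ]′ (toSum (a Fin.≟ b))
      where
      off-diagonal : a ≢ b → A a b ≡ A b a
      off-diagonal a≢b = begin
        q * δ a b + (δ a b * d a - W a b) ≡⟨ cong₂ (λ x y → q * x + (x * d a - y)) (δ-≢ a≢b) (W-sym a b) ⟩
        q * 0# + (0# * d a - W b a)
          ≡⟨ solve 4 (λ q x y w → q :* :0 :+ (:0 :* x :- w) := q :* :0 :+ (:0 :* y :- w)) refl q (d a) (d b) (W b a) ⟩
        q * 0# + (0# * d b - W b a)       ≡⟨ cong (λ x → q * x + (x * d b - W b a)) (sym (δ-≢ (a≢b ∘ sym))) ⟩
        q * δ b a + (δ b a * d b - W b a) ∎

    K-sym : ∀ i j → K i j ≡ K j i
    K-sym i j = *-cancelˡ (pos⇒≢0 0<q) (begin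
      q * K i j
        ≡⟨ sym (Σ-δ n i (λ b → q * K b j)) ⟩
      Σ n (λ b → δ i b * (q * K b j))
        ≡⟨ Σ-cong n (λ b → trans (solve 3 (λ x q k → x :* (q :* k) := q :* x :* k) refl (δ i b) q (K b j))
                                 (cong (λ x → q * x * K b j) (δ-sym i b))) ⟩
      Σ n (λ b → q * δ b i * K b j)
        ≡⟨ Σ-cong n (λ b → cong (_* K b j) (sym (K-inverse b i))) ⟩
      Σ n (λ b → (A ⊗ K) b i * K b j)
        ≡⟨ Σ-cong n (λ b → *-distribʳ-Σ n (K b j) _) ⟩
      Σ n (λ b → Σ n (λ a → A b a * K a i * K b j))
        ≡⟨ Σ-comm n n _ ⟩
      Σ n (λ a → Σ n (λ b → A b a * K a i * K b j))
        ≡⟨ Σ-cong n (λ a → Σ-cong n (λ b → trans (cong (λ x → x * K a i * K b j) (A-sym b a))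
             (solve 3 (λ x y z → x :* y :* z := y :* (x :* z)) refl (A a b) (K a i) (K b j)))) ⟩
      Σ n (λ a → Σ n (λ b → K a i * (A a b * K b j)))
        ≡⟨ Σ-cong n (λ a → sym (*-distribˡ-Σ n (K a i) _)) ⟩
      Σ n (λ a → K a i * (A ⊗ K) a j)
        ≡⟨ Σ-cong n (λ a → trans (cong (K a i *_) (K-inverse a j))
             (trans (solve 3 (λ k q x → k :* (q :* x) := x :* (q :* k)) refl (K a i) q (δ a j))
                    (cong (_* (q * K a i)) (δ-sym a j)))) ⟩
      Σ n (λ a → δ j a * (q * K a i))
        ≡⟨ Σ-δ n j (λ a → q * K a i) ⟩
      q * K j i ∎)

    Σ-K· : ∀ v → Σ n (K · v) ≡ Σ n v
    Σ-K· v = begin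
      Σ n (λ i → Σ n (λ j → K i j * v j))  ≡⟨ Σ-comm n n _ ⟩
      Σ n (λ j → Σ n (λ i → K i j * v j))  ≡⟨ Σ-cong n (λ j → sym (*-distribʳ-Σ n (v j) (λ i → K i j))) ⟩
      Σ n (λ j → Σ n (λ i → K i j) * v j)  ≡⟨ Σ-cong n (λ j → cong (_* v j) (trans (Σ-cong n (λ i → K-sym i j)) (K-rowsum j))) ⟩
      Σ n (λ j → 1# * v j)                 ≡⟨ Σ-cong n (λ j → *-identityˡ (v j)) ⟩
      Σ n v                                ∎

    quad-K⊗K : ∀ y → quad (K ⊗ K) y ≡ Σ n (λ i → (K · y) i * (K · y) i)
    quad-K⊗K y = begin
      Σ n (λ i → y i * ((K ⊗ K) · y) i)                 ≡⟨ Σ-cong n (λ i → cong (y i *_) (⊗-·-assoc K K y i)) ⟩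
      Σ n (λ i → y i * (K · (K · y)) i)                 ≡⟨ Σ-*-·-transpose y K (K · y) ⟩
      Σ n (λ k → Σ n (λ i → K i k * y i) * (K · y) k)   ≡⟨ Σ-cong n (λ k → cong (_* (K · y) k) (Σ-cong n (λ i → cong (_* y i) (K-sym i k)))) ⟩
      Σ n (λ k → (K · y) k * (K · y) k)                 ∎

    Σ-var : ∀ y → Σ n (λ i → var q W (λ p → y (root p i))) ≡ quad (λ i j → δ i j - (K ⊗ K) i j) y
    Σ-var y = begin
      Σ n (λ i → var q W (λ p → y (root p i)))
        ≡⟨ Σ-cong n (λ i → trans (var-formula _) (cong₂ (λ a b → a - b * b) (𝔼-root y² i) (𝔼-root y i))) ⟩
      Σ n (λ i → (K · y²) i - (K · y) i * (K · y) i)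
        ≡⟨ Σ-distrib-- n _ _ ⟩
      Σ n (K · y²) - Σ n (λ i → (K · y) i * (K · y) i)
        ≡⟨ cong₂ _-_ (trans (Σ-K· y²) (sym (quad-δ y))) (sym (quad-K⊗K y)) ⟩
      quad δ y - quad (K ⊗ K) y
        ≡⟨ sym (quad-- δ (K ⊗ K) y) ⟩
      quad (λ i j → δ i j - (K ⊗ K) i j) y ∎
      where
      y² : Fin n → Carrier
      y² l = y l * y l

    𝔼-squared-error : ∀ y → 𝔼 q W (λ p → Σ n (λ i → (y (root p i) - (K · y) i) * (y (root p i) - (K · y) i)))
                          ≡ Σ n (λ i → var q W (λ p → y (root p i)))
    𝔼-squared-error y = trans (𝔼-Σ n (λ p i → (y (root p i) - (K · y) i) * (y (root p i) - (K · y) i)))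
      (Σ-cong n (λ i → cong (λ μ → 𝔼 q W (λ p → (y (root p i) - μ) * (y (root p i) - μ))) (sym (𝔼-root y i))))

proposition1 : (F : OrderedField) →
    let open OrderedField F in
    let open Graph F in
    (n : ℕ) (W : Matrix n) →
    (∀ i j → W i j ≡ W j i) →
    (∀ i j → 0# ≤ W i j) →
    (q : Carrier) → 0# < q →
    (K : Matrix n) →
    (∀ i j → ((λ a b → q * δ a b + laplacian W a b) ⊗ K) i j ≡ q * δ i j) →
    (y : Fin n → Carrier) →
    let x̂ = K · y in
    let x̃ = λ (p : ParentMap n) (i : Fin n) → y (root p i) in
    (∀ i → 𝔼 q W (λ p → x̃ p i) ≡ x̂ i)
    × (𝔼 q W (λ p → Σ n (λ i → (x̃ p i - x̂ i) * (x̃ p i - x̂ i)))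
         ≡ Σ n (λ i → var q W (λ p → x̃ p i)))
    × (Σ n (λ i → var q W (λ p → x̃ p i))
         ≡ quad (λ i j → δ i j - (K ⊗ K) i j) y)
proposition1 F n W W-sym W-nonneg q 0<q K K-inverse y =
  𝔼-root y , 𝔼-squared-error y , Σ-var y
  where open Laplacian.Regularisation F n W W-sym W-nonneg q 0<q K K-inverse
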